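{- Let $\Sigma$ be a finite ranked set and let $\lceil\mathsf{H}\Sigma\rceil$ denote the ranked set of models $\lceil G\rceil$ for $G\in\mathsf{H}\Sigma$ (the model has the arity of $G$). For every ranked set $X$ and every $G\in\mathsf{H}X$ there is an operation $f$, mapping $X$-indexed families of models to models, which is compatible with counting MSO and satisfies, for every arity-preserving valuation $\eta:X\to\mathsf{H}\Sigma$, $$f\big((\lceil\eta(x)\rceil)_{x\in X}\big)=\lceil [\![G]\!](\eta)\rceil,$$ where $[\![G]\!](\eta)\in\mathsf{H}\Sigma$ is the flattening of the sourced hypergraph obtained from $G$ by replacing each label $x$ by $\eta(x)$.
   Context: Ranked sets have arities in $\{0,1,\dots\}$. $\mathsf{H}\Sigma$: finite sourced hypergraphs over $\Sigma$ up to isomorphism (finite vertex set; finite ranked set of hyperedges, each $n$-ary hyperedge $e$ having a non-repeating incidence list $e[1..n]$ of vertices; arity-preserving labels in $\Sigma$; for arity $n$ an injective source function $\{1..n\}\to$ vertices). Flattening of $G'\in\mathsf{H}\mathsf{H}\Sigma$: hyperedges are $(e,f)$ with $f$ a hyperedge of the label of hyperedge $e$ of $G'$ (label from $f$); vertices are vertices of $G'$ and $(e,v)$ for non-source vertices $v$ of the label of $e$; sources from $G'$; the incidence list of $(e,f)$ is that of $f$ with $v\mapsto(e,v)$ for non-sources and $v\mapsto e[i]$ if $v$ is the $i$-th source of the label of $e$. The model $\lceil G\rceil$ of $G\in\mathsf{H}\Sigma$: universe is the disjoint union of vertices and hyperedges; for each $a\in\Sigma$ a unary relation of hyperedges labelled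 $a$; for each $i$ up to the maximal arity in $\Sigma$ a binary relation $\{(e,v):e[i]=v\}$; for each $i\le$ arity of $G$ a constant for the $i$-th source. Counting MSO: MSO with predicates $|X|\equiv k\bmod m$. For $r\in\mathbb N$ and $M\subseteq\mathbb N$, let $\approx_{r,M}$ relate models over the same vocabulary satisfying the same counting MSO sentences of quantifier rank at most $r$ whose modulo predicates use moduli from $M$. An operation $f$ on tuples of models is compatible with counting MSO if for all $r,M$, whenever inputs are componentwise $\approx_{r,M}$-equivalent, the outputs are $\approx_{r,M}$-equivalent. -}

module Defs where

open import Data.Nat using (ℕ; zero; suc; _+_; _⊔_; _%_; NonZero; _≤_; _<?_)
open import Data.Fin using (Fin; zero; suc; _↑ˡ_; _↑ʳ_; splitAt; toℕ; fromℕ<; _≟_)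
open import Data.Fin.Subset using (Subset; _∈_; ∣_∣)
open import Data.Vec using (Vec; []; _∷_; map)
open import Data.Bool using (Bool; true; false)
open import Data.Sum using (_⊎_; inj₁; inj₂; [_,_])
open import Data.Product using (Σ; _,_; proj₁; proj₂; _×_)
open import Data.Empty using (⊥)
open import Data.Unit using (⊤)
open import Relation.Nullary using (¬_; yes; no)
open import Relation.Nullary.Decidable using (⌊_⌋)
open import Relation.Binary.PropositionalEquality using (_≡_)
open import Function using (_∘_)
open import Function.Bundles using (_⇔_; _↔_; Inverse)
open import Function.Definitions using (Injective)

record RankedSet : Set₁ where
  field
    Carrier : Set
    arity   : Carrier → ℕ
open RankedSet public

FinRanked : (s : ℕ) → (Fin s → ℕ) → RankedSet
FinRanked s ar = record { Carrier = Fin s ; arity = ar }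

-- Sourced hypergraphs (concrete representatives; H A n is taken up to
-- isomorphism, every class has a representative whose vertex set is
-- Fin n ⊎ Fin inner with the i-th source being inj₁ i).

Vtx : ℕ → ℕ → Set
Vtx n k = Fin n ⊎ Fin k

record Hypergraph (A : RankedSet) (n : ℕ) : Set where
  field
    inner : ℕ
    edges : ℕ
    label : Fin edges → Carrier A
    att   : (e : Fin edges) → Fin (arity A (label e)) → Vtx n inner
open Hypergraph public

WellFormed : ∀ {A n} → Hypergraph A n → Set
WellFormed G = ∀ e → Injective _≡_ _≡_ (att G e)

HR : RankedSet → RankedSet
HR A = record { Carrier = Σ ℕ (Hypergraph A) ; arity = proj₁ }

ΣN : (E : ℕ) → (Fin E → ℕ) → ℕ
ΣN zero    k = 0
ΣN (suc E) k = k zero + ΣN E (k ∘ suc)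

joinΣ : ∀ {E} (k : Fin E → ℕ) (e : Fin E) → Fin (k e) → Fin (ΣN E k)
joinΣ {suc E} k zero    w = w ↑ˡ ΣN E (k ∘ suc)
joinΣ {suc E} k (suc e) w = k zero ↑ʳ joinΣ (k ∘ suc) e w

splitΣ : ∀ {E} (k : Fin E → ℕ) → Fin (ΣN E k) → Σ (Fin E) (λ e → Fin (k e))
splitΣ {suc E} k c =
  [ (λ w → zero , w)
  , (λ c' → suc (proj₁ (splitΣ (k ∘ suc) c')) , proj₂ (splitΣ (k ∘ suc) c')) ]
  (splitAt (k zero) c)

substLab : ∀ {X : RankedSet} {Sg : RankedSet} {n} →
  Hypergraph X n → ((x : Carrier X) → Hypergraph Sg (arity X x)) →
  Hypergraph (HR Sg) n
substLab {X} G η = record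
  { inner = inner G
  ; edges = edges G
  ; label = λ e → arity X (label G e) , η (label G e)
  ; att   = att G }

flatten : ∀ {Sg : RankedSet} {n} → Hypergraph (HR Sg) n → Hypergraph Sg n
flatten {Sg} {n} G = record
  { inner = inner G + ΣN (edges G) innerOf
  ; edges = ΣN (edges G) edgesOf
  ; label = λ c → label (lab (e₀ c)) (f₀ c)
  ; att   = λ c i → vmap (e₀ c) (att (lab (e₀ c)) (f₀ c) i) }
  where
  lab : (e : Fin (edges G)) → Hypergraph Sg (proj₁ (label G e))
  lab e = proj₂ (label G e)
  innerOf edgesOf : Fin (edges G) → ℕ
  innerOf e = inner (lab e)
  edgesOf e = edges (lab e)
  e₀ : Fin (ΣN (edges G) edgesOf) → Fin (edges G)
  e₀ c = proj₁ (splitΣ edgesOf c)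
  f₀ : (c : Fin (ΣN (edges G) edgesOf)) → Fin (edges (lab (e₀ c)))
  f₀ c = proj₂ (splitΣ edgesOf c)
  liftG : Vtx n (inner G) → Vtx n (inner G + ΣN (edges G) innerOf)
  liftG (inj₁ i) = inj₁ i
  liftG (inj₂ v) = inj₂ (v ↑ˡ ΣN (edges G) innerOf)
  vmap : (e : Fin (edges G)) → Vtx (proj₁ (label G e)) (inner (lab e)) →
         Vtx n (inner G + ΣN (edges G) innerOf)
  vmap e (inj₁ j) = liftG (att G e j)
  vmap e (inj₂ w) = inj₂ (inner G ↑ʳ joinΣ innerOf e w)

⟦_⟧ : ∀ {X Sg : RankedSet} {n} →
  Hypergraph X n → ((x : Carrier X) → Hypergraph Sg (arity X x)) → Hypergraph Sg n
⟦ G ⟧ η = flatten (substLab G η)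

record Vocab : Set₁ where
  field
    Rel    : Set
    relAr  : Rel → ℕ
    Const  : Set
open Vocab public

record Model (V : Vocab) : Set where
  field
    size  : ℕ
    rel   : (R : Rel V) → Vec (Fin size) (relAr V R) → Bool
    const : Const V → Fin size
open Model public

record _≅_ {V : Vocab} (A B : Model V) : Set where
  field
    bij      : Fin (size A) ↔ Fin (size B)
    relPres  : ∀ R (xs : Vec (Fin (size A)) (relAr V R)) →
               rel B R (map (Inverse.to bij) xs) ≡ rel A R xs
    constPres : ∀ c → Inverse.to bij (const A c) ≡ const B c

data Term (V : Vocab) (nf : ℕ) : Set where
  var : Fin nf → Term V nf
  con : Const V → Term V nf

data Formula (V : Vocab) (nf ns : ℕ) : Set where
  atom  : (R : Rel V) → Vec (Term V nf) (relAr V R) → Formula V nf ns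
  eq    : Term V nf → Term V nf → Formula V nf ns
  mem   : Term V nf → Fin ns → Formula V nf ns
  cnt   : (k m : ℕ) → .{{NonZero m}} → Fin ns → Formula V nf ns
  neg   : Formula V nf ns → Formula V nf ns
  and   : Formula V nf ns → Formula V nf ns → Formula V nf ns
  ex1   : Formula V (suc nf) ns → Formula V nf ns
  ex2   : Formula V nf (suc ns) → Formula V nf ns

Sentence : Vocab → Set
Sentence V = Formula V 0 0

qr : ∀ {V nf ns} → Formula V nf ns → ℕ
qr (atom R ts) = 0
qr (eq t u)   = 0
qr (mem t X)  = 0
qr (cnt k m X) = 0
qr (neg φ)    = qr φ
qr (and φ ψ)  = qr φ ⊔ qr ψ
qr (ex1 φ)    = suc (qr φ)
qr (ex2 φ)    = suc (qr φ)

ModuliIn : ∀ {V nf ns} → (ℕ → Set) → Formula V nf ns → Set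
ModuliIn M (atom R ts)  = ⊤
ModuliIn M (eq t u)    = ⊤
ModuliIn M (mem t X)   = ⊤
ModuliIn M (cnt k m X) = M m
ModuliIn M (neg φ)     = ModuliIn M φ
ModuliIn M (and φ ψ)   = ModuliIn M φ × ModuliIn M ψ
ModuliIn M (ex1 φ)     = ModuliIn M φ
ModuliIn M (ex2 φ)     = ModuliIn M φ

evalT : ∀ {V nf} (A : Model V) → (Fin nf → Fin (size A)) → Term V nf → Fin (size A)
evalT A ρ (var i) = ρ i
evalT A ρ (con c) = const A c

extend : ∀ {B : Set} {n} → (Fin n → B) → B → Fin (suc n) → B
extend ρ b zero    = b
extend ρ b (suc i) = ρ i

Sat : ∀ {V nf ns} (A : Model V) → (Fin nf → Fin (size A)) →
      (Fin ns → Subset (size A)) → Formula V nf ns → Set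
Sat A ρ σ (atom R ts)  = rel A R (map (evalT A ρ) ts) ≡ true
Sat A ρ σ (eq t u)    = evalT A ρ t ≡ evalT A ρ u
Sat A ρ σ (mem t X)   = evalT A ρ t ∈ σ X
Sat A ρ σ (cnt k m X) = ∣ σ X ∣ % m ≡ k % m
Sat A ρ σ (neg φ)     = ¬ Sat A ρ σ φ
Sat A ρ σ (and φ ψ)   = Sat A ρ σ φ × Sat A ρ σ ψ
Sat A ρ σ (ex1 φ)     = Σ (Fin (size A)) λ a → Sat A (extend ρ a) σ φ
Sat A ρ σ (ex2 φ)     = Σ (Subset (size A)) λ S → Sat A ρ (extend σ S) φ

_⊨_ : ∀ {V} → Model V → Sentence V → Set
A ⊨ φ = Sat A (λ ()) (λ ()) φ

Equiv : ∀ {V} → ℕ → (ℕ → Set) → Model V → Model V → Set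
Equiv {V} r M A B = (φ : Sentence V) → qr φ ≤ r → ModuliIn M φ → (A ⊨ φ) ⇔ (B ⊨ φ)

CompatibleCMSO : ∀ {I : Set} {Vs : I → Vocab} {W : Vocab} →
  (((i : I) → Model (Vs i)) → Model W) → Set₁
CompatibleCMSO {I} {Vs} f = ∀ (r : ℕ) (M : ℕ → Set) (As Bs : (i : I) → Model (Vs i)) →
  (∀ i → Equiv r M (As i) (Bs i)) → Equiv r M (f As) (f Bs)

maxAr : ∀ {s} → (Fin s → ℕ) → ℕ
maxAr {zero}  ar = 0
maxAr {suc s} ar = ar zero ⊔ maxAr (ar ∘ suc)

-- relations: inj₁ a = label a (unary); inj₂ j = incidence relation for
-- position j+1 (binary);  constants: the sources
VocΣ : ∀ {s} → (Fin s → ℕ) → ℕ → Vocab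
VocΣ {s} ar n = record
  { Rel = Fin s ⊎ Fin (maxAr ar)
  ; relAr = [ (λ _ → 1) , (λ _ → 2) ]
  ; Const = Fin n }

⌈_⌉ : ∀ {s} {ar : Fin s → ℕ} {n} → Hypergraph (FinRanked s ar) n → Model (VocΣ ar n)
⌈_⌉ {s} {ar} {n} G = record
  { size  = (n + inner G) + edges G
  ; rel   = r
  ; const = λ i → encV (inj₁ i) }
  where
  N = (n + inner G) + edges G
  encV : Vtx n (inner G) → Fin N
  encV (inj₁ i) = (i ↑ˡ inner G) ↑ˡ edges G
  encV (inj₂ j) = (n ↑ʳ j) ↑ˡ edges G
  isLab : Fin s → Fin N → Bool
  isLab a x = [ (λ _ → false) , (λ e → ⌊ label G e ≟ a ⌋) ] (splitAt (n + inner G) x)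
  incAt : Fin (maxAr ar) → Fin (edges G) → Fin N → Bool
  incAt j e y with toℕ j <? ar (label G e)
  ... | yes p = ⌊ encV (att G e (fromℕ< p)) ≟ y ⌋
  ... | no _  = false
  isInc : Fin (maxAr ar) → Fin N → Fin N → Bool
  isInc j x y = [ (λ _ → false) , (λ e → incAt j e y) ] (splitAt (n + inner G) x)
  r : (R : Fin s ⊎ Fin (maxAr ar)) → Vec (Fin N) ([ (λ _ → 1) , (λ _ → 2) ] R) → Bool
  r (inj₁ a) (x ∷ [])     = isLab a x
  r (inj₂ j) (x ∷ y ∷ []) = isInc j x y

-- The operation glues its arguments along G: each argument is normalised so that its sources come first,
-- its j-th source is identified with the vertex att e j of G, and a tuple is related in the result iff it is
-- the image of a related tuple of one argument.  Compatibility is a Feferman–Vaught argument with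
-- Ehrenfeucht–Fraïssé games: by Hintikka formulas, ≈_{r,M}-equivalent arguments give the duplicator winning
-- strategies in the r-round counting-MSO game with moduli of the sentence at hand, and these combine into a
-- strategy on the glued models, because every pebble lies on a vertex of G or in the interior of exactly one
-- argument and set sizes add up over the arguments.  Applied to the models ⌈η x⌉, the gluing is isomorphic to
-- ⌈⟦G⟧η⌉: both consist of the vertices of G together with the new vertices and hyperedges of every piece.

module Submission where

open import Defs
open import Level using (0ℓ)
open import Data.Bool using (Bool; true; false) renaming (_≟_ to _≟ᵇ_)
open import Data.Bool.Properties using (⇔→≡)
open import Data.Empty using (⊥; ⊥-elim)
open import Data.Fin using (Fin; zero; suc; _↑ˡ_; _↑ʳ_; splitAt; join; toℕ; fromℕ<; punchIn; punchOut) renaming (_≟_ to _≟ᶠ_)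
open import Data.Fin.Properties using (+↔⊎; splitAt-join; all?; any?; splitAt-↑ˡ; splitAt-↑ʳ; splitAt⁻¹-↑ˡ; splitAt⁻¹-↑ʳ; ↑ˡ-injective; ↑ʳ-injective; punchOut-injective; punchIn-punchOut; punchOut-punchIn; punchInᵢ≢i; punchOut-cong; suc-injective)
open import Data.Fin.Subset using (Subset; _∈_; ∣_∣) renaming (⊥ to ∅)
open import Data.Fin.Subset.Properties using (_∈?_; anySubset?)
open import Data.List using (List; []; _∷_; _++_)
open import Data.List.Membership.Propositional using () renaming (_∈_ to _∈ₗ_)
open import Data.List.Membership.Propositional.Properties using (∈-++⁺ˡ; ∈-++⁺ʳ)
open import Data.List.Relation.Unary.All using (All; []; _∷_)
import Data.List.Relation.Unary.All as All
open import Data.List.Relation.Unary.All.Properties using (++⁺)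
open import Data.List.Relation.Unary.Any using (here; there)
open import Data.Nat using (ℕ; zero; suc; _+_; _%_; NonZero; _≤_; _<_; _<?_; z≤n; s≤s) renaming (_≟_ to _≟ⁿ_)
open import Data.Nat.DivMod using ([m+n]%n≡m%n; %-distribˡ-+; m%n%n≡m%n)
open import Data.Nat.Properties using (+-0-commutativeMonoid; m+n≡0⇒n≡0; +-assoc; +-suc; <-irrelevant; m⊔n≤o⇒m≤o; m⊔n≤o⇒n≤o; ⊔-lub)
open import Algebra.Properties.CommutativeMonoid.Sum +-0-commutativeMonoid using (sum; sum-permute; sum-cong-≗)
open import Data.Product using (Σ; _,_; proj₁; proj₂; _×_)
open import Data.Product.Function.Dependent.Propositional using (Σ-↔)
open import Data.Product.Function.NonDependent.Propositional using (_×-⇔_)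
open import Data.Sum using (_⊎_; inj₁; inj₂; [_,_])
open import Data.Sum.Algebra using (⊎-assoc; ⊎-cong)
open import Data.Sum.Properties using (inj₂-injective)
open import Data.Unit using (⊤; tt)
open import Data.Vec using (Vec; []; _∷_; map; lookup; tabulate)
open import Data.Vec.Properties using (≡-dec; map-cong; map-∘; map-id; []=⇒lookup; lookup⇒[]=; lookup∘tabulate; tabulate∘lookup; tabulate-cong; ∷-injective; ∷-injectiveˡ; ∷-injectiveʳ)
open import Function using (_∘_; _∘′_; id)
open import Function.Bundles using (_⇔_; mk⇔; Equivalence; Inverse; Injection; _↔_; mk↔ₛ′)
open import Function.Construct.Composition using (_↔-∘_)
open import Function.Construct.Identity using (↔-id; ⇔-id)
open import Function.Construct.Symmetry using (↔-sym)
open import Function.Definitions using (Injective)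
open import Function.Properties.Equivalence using () renaming (trans to ⇔-trans; sym to ⇔-sym)
open import Function.Properties.Inverse using (↔⇒↣)
open import Function.Related.Propositional using (module EquationalReasoning; bijection)
open import Function.Related.TypeIsomorphisms using (¬-cong-⇔; Σ-distribˡ-⊎)
open import Relation.Nullary using (¬_; Dec; yes; no; does; ¬?; _→-dec_)
open import Relation.Nullary.Decidable using (_×-dec_; ⌊_⌋)
open import Relation.Binary.PropositionalEquality using (_≡_; _≢_; _≗_; refl; sym; trans; cong; cong₂; module ≡-Reasoning)

open Equivalence using (to; from)

subst₂-⇔ : ∀ {A B : Set} (P : A → B → Set) {x x' y y'} → x ≡ x' → y ≡ y' → P x y ⇔ P x' y'
subst₂-⇔ P refl refl = mk⇔ id id


Sat? : ∀ {V nf ns} (A : Model V) ρ σ (φ : Formula V nf ns) → Dec (Sat A ρ σ φ)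
Sat? A ρ σ (atom R ts) = rel A R (map (evalT A ρ) ts) ≟ᵇ true
Sat? A ρ σ (eq t u)    = evalT A ρ t ≟ᶠ evalT A ρ u
Sat? A ρ σ (mem t X)   = evalT A ρ t ∈? σ X
Sat? A ρ σ (cnt k m X) = ∣ σ X ∣ % m ≟ⁿ k % m
Sat? A ρ σ (neg φ)     = ¬? (Sat? A ρ σ φ)
Sat? A ρ σ (and φ ψ)   = Sat? A ρ σ φ ×-dec Sat? A ρ σ ψ
Sat? A ρ σ (ex1 φ)     = any? (λ a → Sat? A (extend ρ a) σ φ)
Sat? A ρ σ (ex2 φ)     = anySubset? (λ S → Sat? A ρ (extend σ S) φ)

bit : Bool → ℕ
bit true  = 1
bit false = 0

∣S∣≡sum : ∀ {n} (S : Subset n) → ∣ S ∣ ≡ sum (λ i → bit (lookup S i))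
∣S∣≡sum []          = refl
∣S∣≡sum (true ∷ S)  = cong suc (∣S∣≡sum S)
∣S∣≡sum (false ∷ S) = ∣S∣≡sum S

subst-⇔ : ∀ {A : Set} (P : A → Set) {x y} → x ≡ y → P x ⇔ P y
subst-⇔ P refl = mk⇔ id id

extend-≗ : ∀ {B C : Set} {n} (g : B → C) {ρ : Fin n → B} {ρ' b b'} →
  g ∘ ρ ≗ ρ' → g b ≡ b' → g ∘ extend ρ b ≗ extend ρ' b'
extend-≗ g gρ≗ρ' gb≡b' zero    = gb≡b'
extend-≗ g gρ≗ρ' gb≡b' (suc i) = gρ≗ρ' i

evalT-cong : ∀ {V nf} (A : Model V) {ρ ρ' : Fin nf → Fin (size A)} → ρ ≗ ρ' → ∀ t → evalT A ρ t ≡ evalT A ρ' t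
evalT-cong A ρ≗ρ' (var i) = ρ≗ρ' i
evalT-cong A ρ≗ρ' (con c) = refl

≅-refl : ∀ {V} {A : Model V} → A ≅ A
≅-refl {A = A} = record
  { bij = mk↔ₛ′ id id (λ _ → refl) (λ _ → refl)
  ; relPres = λ R xs → cong (rel A R) (map-id xs)
  ; constPres = λ _ → refl }

module Transport {V : Vocab} {A B : Model V} (A≅B : A ≅ B) where
  open _≅_ A≅B

  ⇑ : Fin (size A) → Fin (size B)
  ⇑ = Inverse.to bij

  ⇓ : Fin (size B) → Fin (size A)
  ⇓ = Inverse.from bij

  ⇑⇓ : ∀ b → ⇑ (⇓ b) ≡ b
  ⇑⇓ = Inverse.strictlyInverseˡ bij

  ⇓⇑ : ∀ a → ⇓ (⇑ a) ≡ a
  ⇓⇑ = Inverse.strictlyInverseʳ bij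

  ⇑-injective : ∀ {a a'} → ⇑ a ≡ ⇑ a' → a ≡ a'
  ⇑-injective {a} {a'} p = trans (sym (⇓⇑ a)) (trans (cong ⇓ p) (⇓⇑ a'))

  image : Subset (size A) → Subset (size B)
  image S = tabulate (lookup S ∘ ⇓)

  preimage : Subset (size B) → Subset (size A)
  preimage T = tabulate (lookup T ∘ ⇑)

  lookup-image : ∀ S a → lookup (image S) (⇑ a) ≡ lookup S a
  lookup-image S a = trans (lookup∘tabulate _ (⇑ a)) (cong (lookup S) (⇓⇑ a))

  image-preimage : ∀ T → image (preimage T) ≡ T
  image-preimage T =
    trans (tabulate-cong λ b → trans (lookup∘tabulate _ (⇓ b)) (cong (lookup T) (⇑⇓ b))) (tabulate∘lookup T)

  ∈-image : ∀ {a} S → a ∈ S ⇔ ⇑ a ∈ image S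
  ∈-image {a} S = mk⇔
    (λ p → lookup⇒[]= (⇑ a) (image S) (trans (lookup-image S a) ([]=⇒lookup p)))
    (λ p → lookup⇒[]= a S (trans (sym (lookup-image S a)) ([]=⇒lookup p)))

  ∣image∣ : ∀ S → ∣ image S ∣ ≡ ∣ S ∣
  ∣image∣ S = begin
    ∣ image S ∣                              ≡⟨ ∣S∣≡sum (image S) ⟩
    sum (λ b → bit (lookup (image S) b))     ≡⟨ sum-permute _ bij ⟩
    sum (λ a → bit (lookup (image S) (⇑ a))) ≡⟨ sum-cong-≗ (cong bit ∘ lookup-image S) ⟩
    sum (λ a → bit (lookup S a))             ≡⟨ sym (∣S∣≡sum S) ⟩
    ∣ S ∣                                    ∎
    where open ≡-Reasoning

  evalT-transport : ∀ {nf} {ρ : Fin nf → Fin (size A)} {ρ'} → ⇑ ∘ ρ ≗ ρ' →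
    ∀ t → evalT B ρ' t ≡ ⇑ (evalT A ρ t)
  evalT-transport ⇑ρ≗ρ' (var i) = sym (⇑ρ≗ρ' i)
  evalT-transport ⇑ρ≗ρ' (con c) = sym (constPres c)

  Sat-transport : ∀ {nf ns} {ρ : Fin nf → Fin (size A)} {ρ'} {σ : Fin ns → Subset (size A)} {σ'} →
    ⇑ ∘ ρ ≗ ρ' → image ∘ σ ≗ σ' → ∀ φ → Sat A ρ σ φ ⇔ Sat B ρ' σ' φ
  Sat-transport {ρ = ρ} {ρ'} ⇑ρ≗ρ' σ≗ (atom R ts) = subst-⇔ (_≡ true) (begin
    rel A R (map (evalT A ρ) ts)            ≡⟨ relPres R _ ⟨
    rel B R (map ⇑ (map (evalT A ρ) ts))    ≡⟨ cong (rel B R) (map-∘ ⇑ (evalT A ρ) ts) ⟨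
    rel B R (map (⇑ ∘ evalT A ρ) ts)        ≡⟨ cong (rel B R) (map-cong (sym ∘ evalT-transport ⇑ρ≗ρ') ts) ⟩
    rel B R (map (evalT B ρ') ts)           ∎)
    where open ≡-Reasoning
  Sat-transport ⇑ρ≗ρ' σ≗ (eq t u) = ⇔-trans (mk⇔ (cong ⇑) ⇑-injective)
    (subst₂-⇔ _≡_ (sym (evalT-transport ⇑ρ≗ρ' t)) (sym (evalT-transport ⇑ρ≗ρ' u)))
  Sat-transport {σ = σ} ⇑ρ≗ρ' σ≗ (mem t X) = ⇔-trans (∈-image (σ X))
    (subst₂-⇔ _∈_ (sym (evalT-transport ⇑ρ≗ρ' t)) (σ≗ X))
  Sat-transport {σ = σ} ⇑ρ≗ρ' σ≗ (cnt k m X) =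
    subst-⇔ (λ c → c % m ≡ k % m) (trans (sym (∣image∣ (σ X))) (cong ∣_∣ (σ≗ X)))
  Sat-transport ⇑ρ≗ρ' σ≗ (neg φ) = ¬-cong-⇔ (Sat-transport ⇑ρ≗ρ' σ≗ φ)
  Sat-transport ⇑ρ≗ρ' σ≗ (and φ ψ) = Sat-transport ⇑ρ≗ρ' σ≗ φ ×-⇔ Sat-transport ⇑ρ≗ρ' σ≗ ψ
  Sat-transport ⇑ρ≗ρ' σ≗ (ex1 φ) = mk⇔
    (λ (a , p) → ⇑ a , to (Sat-transport (extend-≗ ⇑ ⇑ρ≗ρ' refl) σ≗ φ) p)
    (λ (b , q) → ⇓ b , from (Sat-transport (extend-≗ ⇑ ⇑ρ≗ρ' (⇑⇓ b)) σ≗ φ) q)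
  Sat-transport ⇑ρ≗ρ' σ≗ (ex2 φ) = mk⇔
    (λ (S , p) → image S , to (Sat-transport ⇑ρ≗ρ' (extend-≗ image σ≗ refl) φ) p)
    (λ (T , q) → preimage T , from (Sat-transport ⇑ρ≗ρ' (extend-≗ image σ≗ (image-preimage T)) φ) q)

  ⊨-transport : (φ : Sentence V) → A ⊨ φ ⇔ B ⊨ φ
  ⊨-transport φ = Sat-transport (λ ()) (λ ()) φ

Sat-cong : ∀ {V nf ns} (A : Model V) {ρ ρ' : Fin nf → Fin (size A)} {σ σ' : Fin ns → Subset (size A)} →
  ρ ≗ ρ' → σ ≗ σ' → ∀ φ → Sat A ρ σ φ ⇔ Sat A ρ' σ' φ
Sat-cong A ρ≗ρ' σ≗σ' = Transport.Sat-transport ≅-refl ρ≗ρ' (λ X → trans (tabulate∘lookup _) (σ≗σ' X))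

≅-reflects-Equiv : ∀ {V : Vocab} {r M} {A A' B B' : Model V} → A' ≅ A → B' ≅ B → Equiv r M A B → Equiv r M A' B'
≅-reflects-Equiv A'≅A B'≅B A≈B φ q m =
  ⇔-trans (⊨-transport A'≅A φ) (⇔-trans (A≈B φ q m) (⇔-sym (⊨-transport B'≅B φ)))
  where open Transport using (⊨-transport)

-- Ehrenfeucht–Fraïssé games for counting MSO

module Game (L : List ℕ) {V : Vocab} where

  record AgreeOnAtoms (A B : Model V) {nf ns}
      (ρA : Fin nf → Fin (size A)) (σA : Fin ns → Subset (size A))
      (ρB : Fin nf → Fin (size B)) (σB : Fin ns → Subset (size B)) : Set where
    field
      rel-agree : ∀ R ts → rel A R (map (evalT A ρA) ts) ≡ rel B R (map (evalT B ρB) ts)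
      eq-agree  : ∀ t u → (evalT A ρA t ≡ evalT A ρA u) ⇔ (evalT B ρB t ≡ evalT B ρB u)
      mem-agree : ∀ t X → (evalT A ρA t ∈ σA X) ⇔ (evalT B ρB t ∈ σB X)
      cnt-agree : ∀ m → m ∈ₗ L → .⦃ _ : NonZero m ⦄ → ∀ X → ∣ σA X ∣ % m ≡ ∣ σB X ∣ % m
  open AgreeOnAtoms public

  Position : Model V → Model V → Set₁
  Position A B = ∀ {nf ns} → (Fin nf → Fin (size A)) → (Fin ns → Subset (size A)) →
                 (Fin nf → Fin (size B)) → (Fin ns → Subset (size B)) → Set

  record Round (A B : Model V) (Next : Position A B) {nf ns}
      (ρA : Fin nf → Fin (size A)) (σA : Fin ns → Subset (size A))
      (ρB : Fin nf → Fin (size B)) (σB : Fin ns → Subset (size B)) : Set where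
    field
      atoms     : AgreeOnAtoms A B ρA σA ρB σB
      forthᵉ    : ∀ a → Σ (Fin (size B)) λ b → Next (extend ρA a) σA (extend ρB b) σB
      backᵉ     : ∀ b → Σ (Fin (size A)) λ a → Next (extend ρA a) σA (extend ρB b) σB
      forthˢ    : ∀ S → Σ (Subset (size B)) λ T → Next ρA (extend σA S) ρB (extend σB T)
      backˢ     : ∀ T → Σ (Subset (size A)) λ S → Next ρA (extend σA S) ρB (extend σB T)
  open Round public

  Wins : ℕ → (A B : Model V) → Position A B
  Wins zero    A B = AgreeOnAtoms A B
  Wins (suc r) A B = Round A B (Wins r A B)

  Wins-atoms : ∀ r {A B nf ns} {ρA : Fin nf → Fin (size A)} {σA : Fin ns → Subset (size A)} {ρB σB} →
    Wins r A B ρA σA ρB σB → AgreeOnAtoms A B ρA σA ρB σB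
  Wins-atoms zero    w = w
  Wins-atoms (suc r) w = atoms w

  Wins-sound : ∀ r {A B nf ns} {ρA : Fin nf → Fin (size A)} {σA : Fin ns → Subset (size A)} {ρB σB} →
    Wins r A B ρA σA ρB σB → (φ : Formula V nf ns) → qr φ ≤ r → ModuliIn (_∈ₗ L) φ →
    Sat A ρA σA φ ⇔ Sat B ρB σB φ
  Wins-sound r w (atom R ts) _ _ = subst-⇔ (_≡ true) (rel-agree (Wins-atoms r w) R ts)
  Wins-sound r w (eq t u) _ _ = eq-agree (Wins-atoms r w) t u
  Wins-sound r w (mem t X) _ _ = mem-agree (Wins-atoms r w) t X
  Wins-sound r w (cnt k m X) _ m∈L =
    subst-⇔ (λ c → c ≡ _) (cnt-agree (Wins-atoms r w) m m∈L X)
  Wins-sound r w (neg φ) q m = ¬-cong-⇔ (Wins-sound r w φ q m)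
  Wins-sound r w (and φ ψ) q (mφ , mψ) =
    Wins-sound r w φ (m⊔n≤o⇒m≤o (qr φ) (qr ψ) q) mφ ×-⇔ Wins-sound r w ψ (m⊔n≤o⇒n≤o (qr φ) (qr ψ) q) mψ
  Wins-sound (suc r) w (ex1 φ) (s≤s q) m = mk⇔
    (λ (a , p) → let (b , w') = forthᵉ w a in b , to (Wins-sound r w' φ q m) p)
    (λ (b , p) → let (a , w') = backᵉ w b in a , from (Wins-sound r w' φ q m) p)
  Wins-sound (suc r) w (ex2 φ) (s≤s q) m = mk⇔
    (λ (S , p) → let (T , w') = forthˢ w S in T , to (Wins-sound r w' φ q m) p)
    (λ (T , p) → let (S , w') = backˢ w T in S , from (Wins-sound r w' φ q m) p)

  AgreeOnAtoms-sym : ∀ {A B nf ns} {ρA : Fin nf → Fin (size A)} {σA : Fin ns → Subset (size A)} {ρB σB} →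
    AgreeOnAtoms A B ρA σA ρB σB → AgreeOnAtoms B A ρB σB ρA σA
  AgreeOnAtoms-sym ag = record
    { rel-agree = λ R ts → sym (rel-agree ag R ts)
    ; eq-agree  = λ t u → ⇔-sym (eq-agree ag t u)
    ; mem-agree = λ t X → ⇔-sym (mem-agree ag t X)
    ; cnt-agree = λ m m∈L X → sym (cnt-agree ag m m∈L X) }

  Wins-sym : ∀ r {A B nf ns} {ρA : Fin nf → Fin (size A)} {σA : Fin ns → Subset (size A)} {ρB σB} →
    Wins r A B ρA σA ρB σB → Wins r B A ρB σB ρA σA
  Wins-sym zero    w = AgreeOnAtoms-sym w
  Wins-sym (suc r) w = record
    { atoms  = AgreeOnAtoms-sym (atoms w)
    ; forthᵉ = λ b → let (a , w') = backᵉ w b in a , Wins-sym r w'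
    ; backᵉ  = λ a → let (b , w') = forthᵉ w a in b , Wins-sym r w'
    ; forthˢ = λ T → let (S , w') = backˢ w T in S , Wins-sym r w'
    ; backˢ  = λ S → let (T , w') = forthˢ w S in T , Wins-sym r w' }

  AgreeOnAtoms-cong : ∀ {A B nf ns} {ρA ρA' : Fin nf → Fin (size A)} {σA σA' : Fin ns → Subset (size A)}
    {ρB ρB' : Fin nf → Fin (size B)} {σB σB' : Fin ns → Subset (size B)} →
    ρA ≗ ρA' → σA ≗ σA' → ρB ≗ ρB' → σB ≗ σB' →
    AgreeOnAtoms A B ρA σA ρB σB → AgreeOnAtoms A B ρA' σA' ρB' σB'
  AgreeOnAtoms-cong {A} {B} ρA≗ σA≗ ρB≗ σB≗ ag = record
    { rel-agree = λ R ts → trans (cong (rel A R) (map-cong (sym ∘ evalT-cong A ρA≗) ts))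
                           (trans (rel-agree ag R ts) (cong (rel B R) (map-cong (evalT-cong B ρB≗) ts)))
    ; eq-agree  = λ t u → ⇔-trans (⇔-sym (subst₂-⇔ _≡_ (evalT-cong A ρA≗ t) (evalT-cong A ρA≗ u)))
                           (⇔-trans (eq-agree ag t u) (subst₂-⇔ _≡_ (evalT-cong B ρB≗ t) (evalT-cong B ρB≗ u)))
    ; mem-agree = λ t X → ⇔-trans (⇔-sym (subst₂-⇔ _∈_ (evalT-cong A ρA≗ t) (σA≗ X)))
                           (⇔-trans (mem-agree ag t X) (subst₂-⇔ _∈_ (evalT-cong B ρB≗ t) (σB≗ X)))
    ; cnt-agree = λ m m∈L X → trans (cong (λ S → ∣ S ∣ % m) (sym (σA≗ X)))
                           (trans (cnt-agree ag m m∈L X) (cong (λ S → ∣ S ∣ % m) (σB≗ X))) }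

  Wins-cong : ∀ r {A B nf ns} {ρA ρA' : Fin nf → Fin (size A)} {σA σA' : Fin ns → Subset (size A)}
    {ρB ρB' : Fin nf → Fin (size B)} {σB σB' : Fin ns → Subset (size B)} →
    ρA ≗ ρA' → σA ≗ σA' → ρB ≗ ρB' → σB ≗ σB' →
    Wins r A B ρA σA ρB σB → Wins r A B ρA' σA' ρB' σB'
  Wins-cong zero    ρA≗ σA≗ ρB≗ σB≗ w = AgreeOnAtoms-cong ρA≗ σA≗ ρB≗ σB≗ w
  Wins-cong (suc r) {A} {B} ρA≗ σA≗ ρB≗ σB≗ w = record
    { atoms  = AgreeOnAtoms-cong ρA≗ σA≗ ρB≗ σB≗ (atoms w)
    ; forthᵉ = λ a → let (b , w') = forthᵉ w a in
                     b , Wins-cong r (extend-≗ id ρA≗ refl) σA≗ (extend-≗ id ρB≗ refl) σB≗ w'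
    ; backᵉ  = λ b → let (a , w') = backᵉ w b in
                     a , Wins-cong r (extend-≗ id ρA≗ refl) σA≗ (extend-≗ id ρB≗ refl) σB≗ w'
    ; forthˢ = λ S → let (T , w') = forthˢ w S in
                     T , Wins-cong r ρA≗ (extend-≗ id σA≗ refl) ρB≗ (extend-≗ id σB≗ refl) w'
    ; backˢ  = λ T → let (S , w') = backˢ w T in
                     S , Wins-cong r ρA≗ (extend-≗ id σA≗ refl) ρB≗ (extend-≗ id σB≗ refl) w' }

-- Hintikka formulas

-- A formula with two extra constants, so that empty conjunctions and their negations keep quantifier rank 0.
data Formula⁺ (V : Vocab) (nf ns : ℕ) : Set where
  ⊤⁺ ⊥⁺ : Formula⁺ V nf ns
  ⌜_⌝   : Formula V nf ns → Formula⁺ V nf ns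

module _ {V : Vocab} where

  Sat⁺ : ∀ {nf ns} (A : Model V) → (Fin nf → Fin (size A)) → (Fin ns → Subset (size A)) → Formula⁺ V nf ns → Set
  Sat⁺ A ρ σ ⊤⁺    = ⊤
  Sat⁺ A ρ σ ⊥⁺    = ⊥
  Sat⁺ A ρ σ ⌜ φ ⌝ = Sat A ρ σ φ

  Bounded : ∀ {nf ns} → ℕ → (ℕ → Set) → Formula⁺ V nf ns → Set
  Bounded r M ⌜ φ ⌝ = qr φ ≤ r × ModuliIn M φ
  Bounded r M _     = ⊤

  infixr 6 _∧⁺_

  _∧⁺_ : ∀ {nf ns} → Formula⁺ V nf ns → Formula⁺ V nf ns → Formula⁺ V nf ns
  ⊤⁺    ∧⁺ y     = y
  ⊥⁺    ∧⁺ y     = ⊥⁺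
  ⌜ φ ⌝ ∧⁺ ⊤⁺    = ⌜ φ ⌝
  ⌜ φ ⌝ ∧⁺ ⊥⁺    = ⊥⁺
  ⌜ φ ⌝ ∧⁺ ⌜ ψ ⌝ = ⌜ and φ ψ ⌝

  ¬⁺_ : ∀ {nf ns} → Formula⁺ V nf ns → Formula⁺ V nf ns
  ¬⁺ ⊤⁺    = ⊥⁺
  ¬⁺ ⊥⁺    = ⊤⁺
  ¬⁺ ⌜ φ ⌝ = ⌜ neg φ ⌝

  -- ∃x.⊤ is not valid (the universe may be empty), so it has to be spelled out.
  ∃ᵉ⁺ : ∀ {nf ns} → Formula⁺ V (suc nf) ns → Formula⁺ V nf ns
  ∃ᵉ⁺ ⊤⁺    = ⌜ ex1 (eq (var zero) (var zero)) ⌝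
  ∃ᵉ⁺ ⊥⁺    = ⊥⁺
  ∃ᵉ⁺ ⌜ φ ⌝ = ⌜ ex1 φ ⌝

  ∃ˢ⁺ : ∀ {nf ns} → Formula⁺ V nf (suc ns) → Formula⁺ V nf ns
  ∃ˢ⁺ ⊤⁺    = ⊤⁺
  ∃ˢ⁺ ⊥⁺    = ⊥⁺
  ∃ˢ⁺ ⌜ φ ⌝ = ⌜ ex2 φ ⌝

  module _ {nf ns} (A : Model V) (ρ : Fin nf → Fin (size A)) (σ : Fin ns → Subset (size A)) where

    ∧⁺-sem : ∀ x y → Sat⁺ A ρ σ (x ∧⁺ y) ⇔ (Sat⁺ A ρ σ x × Sat⁺ A ρ σ y)
    ∧⁺-sem ⊤⁺    y     = mk⇔ (tt ,_) proj₂
    ∧⁺-sem ⊥⁺    y     = mk⇔ (λ ()) proj₁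
    ∧⁺-sem ⌜ φ ⌝ ⊤⁺    = mk⇔ (_, tt) proj₁
    ∧⁺-sem ⌜ φ ⌝ ⊥⁺    = mk⇔ (λ ()) proj₂
    ∧⁺-sem ⌜ φ ⌝ ⌜ ψ ⌝ = mk⇔ id id

    ∧⁺-sem₅ : ∀ x₁ x₂ x₃ x₄ x₅ → Sat⁺ A ρ σ (x₁ ∧⁺ x₂ ∧⁺ x₃ ∧⁺ x₄ ∧⁺ x₅) ⇔
      (Sat⁺ A ρ σ x₁ × Sat⁺ A ρ σ x₂ × Sat⁺ A ρ σ x₃ × Sat⁺ A ρ σ x₄ × Sat⁺ A ρ σ x₅)
    ∧⁺-sem₅ x₁ x₂ x₃ x₄ x₅ = ⇔-trans (∧⁺-sem x₁ _) (⇔-id _ ×-⇔ ⇔-trans (∧⁺-sem x₂ _)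
                              (⇔-id _ ×-⇔ ⇔-trans (∧⁺-sem x₃ _) (⇔-id _ ×-⇔ ∧⁺-sem x₄ x₅)))

    ¬⁺-sem : ∀ x → Sat⁺ A ρ σ (¬⁺ x) ⇔ (¬ Sat⁺ A ρ σ x)
    ¬⁺-sem ⊤⁺    = mk⇔ (λ ()) (λ ¬⊤ → ¬⊤ tt)
    ¬⁺-sem ⊥⁺    = mk⇔ (λ _ ()) (λ _ → tt)
    ¬⁺-sem ⌜ φ ⌝ = mk⇔ id id

    ∃ᵉ⁺-sem : ∀ x → Sat⁺ A ρ σ (∃ᵉ⁺ x) ⇔ Σ (Fin (size A)) λ a → Sat⁺ A (extend ρ a) σ x
    ∃ᵉ⁺-sem ⊤⁺    = mk⇔ (λ (a , _) → a , tt) (λ (a , _) → a , refl)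
    ∃ᵉ⁺-sem ⊥⁺    = mk⇔ (λ ()) (λ ())
    ∃ᵉ⁺-sem ⌜ φ ⌝ = mk⇔ id id

    ∃ˢ⁺-sem : ∀ x → Sat⁺ A ρ σ (∃ˢ⁺ x) ⇔ Σ (Subset (size A)) λ S → Sat⁺ A ρ (extend σ S) x
    ∃ˢ⁺-sem ⊤⁺    = mk⇔ (λ _ → ∅ , tt) (λ _ → tt)
    ∃ˢ⁺-sem ⊥⁺    = mk⇔ (λ ()) (λ ())
    ∃ˢ⁺-sem ⌜ φ ⌝ = mk⇔ id id

  module _ {r : ℕ} {M : ℕ → Set} where

    ∧⁺-bounded : ∀ {nf ns} (x y : Formula⁺ V nf ns) → Bounded r M x → Bounded r M y → Bounded r M (x ∧⁺ y)
    ∧⁺-bounded ⊤⁺    y     _       by      = by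
    ∧⁺-bounded ⊥⁺    y     _       _       = tt
    ∧⁺-bounded ⌜ φ ⌝ ⊤⁺    bx      _       = bx
    ∧⁺-bounded ⌜ φ ⌝ ⊥⁺    _       _       = tt
    ∧⁺-bounded ⌜ φ ⌝ ⌜ ψ ⌝ (q , m) (q' , m') = ⊔-lub q q' , m , m'

    ∧⁺-bounded₅ : ∀ {nf ns} (x₁ x₂ x₃ x₄ x₅ : Formula⁺ V nf ns) →
      Bounded r M x₁ → Bounded r M x₂ → Bounded r M x₃ → Bounded r M x₄ → Bounded r M x₅ →
      Bounded r M (x₁ ∧⁺ x₂ ∧⁺ x₃ ∧⁺ x₄ ∧⁺ x₅)
    ∧⁺-bounded₅ x₁ x₂ x₃ x₄ x₅ b₁ b₂ b₃ b₄ b₅ =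
      ∧⁺-bounded x₁ _ b₁ (∧⁺-bounded x₂ _ b₂ (∧⁺-bounded x₃ _ b₃ (∧⁺-bounded x₄ x₅ b₄ b₅)))

    ¬⁺-bounded : ∀ {nf ns} (x : Formula⁺ V nf ns) → Bounded r M x → Bounded r M (¬⁺ x)
    ¬⁺-bounded ⊤⁺    _  = tt
    ¬⁺-bounded ⊥⁺    _  = tt
    ¬⁺-bounded ⌜ φ ⌝ bx = bx

    ∃ᵉ⁺-bounded : ∀ {nf ns} (x : Formula⁺ V (suc nf) ns) → Bounded r M x → Bounded (suc r) M (∃ᵉ⁺ x)
    ∃ᵉ⁺-bounded ⊤⁺    _       = s≤s z≤n , tt
    ∃ᵉ⁺-bounded ⊥⁺    _       = tt
    ∃ᵉ⁺-bounded ⌜ φ ⌝ (q , m) = s≤s q , m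

    ∃ˢ⁺-bounded : ∀ {nf ns} (x : Formula⁺ V nf (suc ns)) → Bounded r M x → Bounded (suc r) M (∃ˢ⁺ x)
    ∃ˢ⁺-bounded ⊤⁺    _       = tt
    ∃ˢ⁺-bounded ⊥⁺    _       = tt
    ∃ˢ⁺-bounded ⌜ φ ⌝ (q , m) = s≤s q , m

  ⋀ᶠ : ∀ {nf ns} n → (Fin n → Formula⁺ V nf ns) → Formula⁺ V nf ns
  ⋀ᶠ zero    g = ⊤⁺
  ⋀ᶠ (suc n) g = g zero ∧⁺ ⋀ᶠ n (g ∘ suc)

  ⋀ˢ : ∀ {nf ns} n → (Subset n → Formula⁺ V nf ns) → Formula⁺ V nf ns
  ⋀ˢ zero    g = g []
  ⋀ˢ (suc n) g = ⋀ˢ n (g ∘ (true ∷_)) ∧⁺ ⋀ˢ n (g ∘ (false ∷_))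

  ⋀ᴸ : ∀ {nf ns} (L : List ℕ) → All NonZero L → ((m : ℕ) → .⦃ NonZero m ⦄ → Formula⁺ V nf ns) → Formula⁺ V nf ns
  ⋀ᴸ []      []         g = ⊤⁺
  ⋀ᴸ (m ∷ L) (nz ∷ nzs) g = g m ⦃ nz ⦄ ∧⁺ ⋀ᴸ L nzs g

  ⋀ᶠ² : ∀ {nf ns} m n → (Fin m → Fin n → Formula⁺ V nf ns) → Formula⁺ V nf ns
  ⋀ᶠ² m n g = ⋀ᶠ m λ i → ⋀ᶠ n (g i)

  module _ {nf ns} (A : Model V) (ρ : Fin nf → Fin (size A)) (σ : Fin ns → Subset (size A)) where

    ⋀ᶠ-sem : ∀ n g → Sat⁺ A ρ σ (⋀ᶠ n g) ⇔ (∀ i → Sat⁺ A ρ σ (g i))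
    ⋀ᶠ-sem zero    g = mk⇔ (λ _ ()) (λ _ → tt)
    ⋀ᶠ-sem (suc n) g = mk⇔
      (λ p → let (p₀ , ps) = to (∧⁺-sem A ρ σ (g zero) _) p in
             λ { zero → p₀ ; (suc i) → to (⋀ᶠ-sem n (g ∘ suc)) ps i })
      (λ h → from (∧⁺-sem A ρ σ (g zero) _) (h zero , from (⋀ᶠ-sem n (g ∘ suc)) (h ∘ suc)))

    ⋀ˢ-sem : ∀ n g → Sat⁺ A ρ σ (⋀ˢ n g) ⇔ (∀ S → Sat⁺ A ρ σ (g S))
    ⋀ˢ-sem zero    g = mk⇔ (λ { p [] → p }) (λ h → h [])
    ⋀ˢ-sem (suc n) g = mk⇔
      (λ p → let (pᵗ , pᶠ) = to (∧⁺-sem A ρ σ (⋀ˢ n _) _) p in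
             λ { (true ∷ S) → to (⋀ˢ-sem n _) pᵗ S ; (false ∷ S) → to (⋀ˢ-sem n _) pᶠ S })
      (λ h → from (∧⁺-sem A ρ σ (⋀ˢ n _) _)
               (from (⋀ˢ-sem n _) (h ∘ (true ∷_)) , from (⋀ˢ-sem n _) (h ∘ (false ∷_))))

    ⋀ᴸ-intro : ∀ L nzs g → (∀ m .⦃ _ : NonZero m ⦄ → Sat⁺ A ρ σ (g m)) → Sat⁺ A ρ σ (⋀ᴸ L nzs g)
    ⋀ᴸ-intro []      []         g h = tt
    ⋀ᴸ-intro (m ∷ L) (nz ∷ nzs) g h = from (∧⁺-sem A ρ σ (g m ⦃ nz ⦄) _) (h m ⦃ nz ⦄ , ⋀ᴸ-intro L nzs g h)

    ⋀ᴸ-elim : ∀ L nzs g → Sat⁺ A ρ σ (⋀ᴸ L nzs g) →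
      ∀ {m} (m∈L : m ∈ₗ L) → Sat⁺ A ρ σ (g m ⦃ All.lookup nzs m∈L ⦄)
    ⋀ᴸ-elim (m ∷ L) (nz ∷ nzs) g p (here refl) = proj₁ (to (∧⁺-sem A ρ σ (g m ⦃ nz ⦄) _) p)
    ⋀ᴸ-elim (m ∷ L) (nz ∷ nzs) g p (there m∈L) = ⋀ᴸ-elim L nzs g (proj₂ (to (∧⁺-sem A ρ σ (g m ⦃ nz ⦄) _) p)) m∈L

    ⋀ᶠ²-sem : ∀ m n g → Sat⁺ A ρ σ (⋀ᶠ² m n g) ⇔ (∀ i j → Sat⁺ A ρ σ (g i j))
    ⋀ᶠ²-sem m n g = mk⇔
      (λ p i → to (⋀ᶠ-sem n (g i)) (to (⋀ᶠ-sem m _) p i))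
      (λ h → from (⋀ᶠ-sem m _) λ i → from (⋀ᶠ-sem n (g i)) (h i))

  module _ {r : ℕ} {M : ℕ → Set} where

    ⋀ᶠ-bounded : ∀ {nf ns} n (g : Fin n → Formula⁺ V nf ns) → (∀ i → Bounded r M (g i)) → Bounded r M (⋀ᶠ n g)
    ⋀ᶠ-bounded zero    g b = tt
    ⋀ᶠ-bounded (suc n) g b = ∧⁺-bounded (g zero) _ (b zero) (⋀ᶠ-bounded n (g ∘ suc) (b ∘ suc))

    ⋀ᶠ²-bounded : ∀ {nf ns} m n (g : Fin m → Fin n → Formula⁺ V nf ns) → (∀ i j → Bounded r M (g i j)) →
      Bounded r M (⋀ᶠ² m n g)
    ⋀ᶠ²-bounded m n g b = ⋀ᶠ-bounded m _ λ i → ⋀ᶠ-bounded n (g i) (b i)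

    ⋀ˢ-bounded : ∀ {nf ns} n (g : Subset n → Formula⁺ V nf ns) → (∀ S → Bounded r M (g S)) → Bounded r M (⋀ˢ n g)
    ⋀ˢ-bounded zero    g b = b []
    ⋀ˢ-bounded (suc n) g b =
      ∧⁺-bounded (⋀ˢ n _) _ (⋀ˢ-bounded n _ (b ∘ (true ∷_))) (⋀ˢ-bounded n _ (b ∘ (false ∷_)))

    ⋀ᴸ-bounded : ∀ {nf ns} L nzs (g : (m : ℕ) → .⦃ NonZero m ⦄ → Formula⁺ V nf ns) →
      All M L → (∀ m .⦃ _ : NonZero m ⦄ → M m → Bounded r M (g m)) → Bounded r M (⋀ᴸ L nzs g)
    ⋀ᴸ-bounded []      []         g []         b = tt
    ⋀ᴸ-bounded (m ∷ L) (nz ∷ nzs) g (Mm ∷ ML) b =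
      ∧⁺-bounded (g m ⦃ nz ⦄) _ (b m ⦃ nz ⦄ Mm) (⋀ᴸ-bounded L nzs g ML b)

  Sat⁺? : ∀ {nf ns} (A : Model V) ρ σ (x : Formula⁺ V nf ns) → Dec (Sat⁺ A ρ σ x)
  Sat⁺? A ρ σ ⊤⁺    = yes tt
  Sat⁺? A ρ σ ⊥⁺    = no λ ()
  Sat⁺? A ρ σ ⌜ φ ⌝ = Sat? A ρ σ φ

  literal : ∀ {nf ns} → Bool → Formula V nf ns → Formula⁺ V nf ns
  literal true  φ = ⌜ φ ⌝
  literal false φ = ⌜ neg φ ⌝

  module _ {nf ns} {A : Model V} {ρ : Fin nf → Fin (size A)} {σ : Fin ns → Subset (size A)} where

    literal-holds : ∀ φ (d : Dec (Sat A ρ σ φ)) → Sat⁺ A ρ σ (literal (does d) φ)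
    literal-holds φ (yes p) = p
    literal-holds φ (no ¬p) = ¬p

    literal-agree : ∀ {B : Model V} {ρ' σ'} φ (d : Dec (Sat A ρ σ φ)) →
      Sat⁺ B ρ' σ' (literal (does d) φ) → Sat A ρ σ φ ⇔ Sat B ρ' σ' φ
    literal-agree φ (yes p) q  = mk⇔ (λ _ → q) (λ _ → p)
    literal-agree φ (no ¬p) ¬q = mk⇔ (⊥-elim ∘ ¬p) (⊥-elim ∘ ¬q)

  literal-bounded : ∀ {nf ns r M} b (φ : Formula V nf ns) → qr φ ≤ r → ModuliIn M φ → Bounded r M (literal b φ)
  literal-bounded true  φ q m = q , m
  literal-bounded false φ q m = q , m

module Hintikka {s : ℕ} (ar : Fin s → ℕ) (k : ℕ) (L : List ℕ) (nzs : All NonZero L) where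
  open Game L

  private
    V : Vocab
    V = VocΣ ar k

  term : ∀ {nf} → Fin (nf + k) → Term V nf
  term {nf} i = [ var , con ] (splitAt nf i)

  term-surjective : ∀ {nf} (t : Term V nf) → Σ (Fin (nf + k)) λ i → term i ≡ t
  term-surjective {nf} (var i) = i ↑ˡ k , cong [ var , con ] (splitAt-↑ˡ nf i k)
  term-surjective {nf} (con c) = nf ↑ʳ c , cong [ var , con ] (splitAt-↑ʳ nf k c)

  module _ {nf ns : ℕ} where
    unaryAtom : Fin s → Fin (nf + k) → Formula V nf ns
    unaryAtom a i = atom (inj₁ a) (term i ∷ [])

    binaryAtom : Fin (maxAr ar) → Fin (nf + k) → Fin (nf + k) → Formula V nf ns
    binaryAtom j i i' = atom (inj₂ j) (term i ∷ term i' ∷ [])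

    eqAtom : Fin (nf + k) → Fin (nf + k) → Formula V nf ns
    eqAtom i i' = eq (term i) (term i')

    memAtom : Fin (nf + k) → Fin ns → Formula V nf ns
    memAtom i X = mem (term i) X

  module _ (A : Model V) {nf ns} (ρ : Fin nf → Fin (size A)) (σ : Fin ns → Subset (size A)) where
    private
      T : ℕ
      T = nf + k

    lit : Formula V nf ns → Formula⁺ V nf ns
    lit α = literal (does (Sat? A ρ σ α)) α

    cntLit : (m : ℕ) → .⦃ NonZero m ⦄ → Fin ns → Formula⁺ V nf ns
    cntLit m X = ⌜ cnt (∣ σ X ∣ % m) m X ⌝

    unaryDiagram binaryDiagram eqDiagram memDiagram cntDiagram diagram : Formula⁺ V nf ns
    unaryDiagram  = ⋀ᶠ² s T λ a i → lit (unaryAtom a i)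
    binaryDiagram = ⋀ᶠ (maxAr ar) binaryDiagramAt
      where binaryDiagramAt : Fin (maxAr ar) → Formula⁺ V nf ns
            binaryDiagramAt j = ⋀ᶠ² T T λ i i' → lit (binaryAtom j i i')
    eqDiagram     = ⋀ᶠ² T T λ i i' → lit (eqAtom i i')
    memDiagram    = ⋀ᶠ² T ns λ i X → lit (memAtom i X)
    cntDiagram    = ⋀ᴸ L nzs λ m → ⋀ᶠ ns (cntLit m)
    diagram       = unaryDiagram ∧⁺ binaryDiagram ∧⁺ eqDiagram ∧⁺ memDiagram ∧⁺ cntDiagram

    lit-holds : ∀ α → Sat⁺ A ρ σ (lit α)
    lit-holds α = literal-holds α (Sat? A ρ σ α)

    diagram-holds : Sat⁺ A ρ σ diagram
    diagram-holds = from (∧⁺-sem₅ A ρ σ unaryDiagram binaryDiagram eqDiagram memDiagram cntDiagram)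
      ( from (⋀ᶠ²-sem A ρ σ s T _) (λ a i → lit-holds (unaryAtom a i))
      , from (⋀ᶠ-sem A ρ σ _ _) (λ j → from (⋀ᶠ²-sem A ρ σ T T _) λ i i' → lit-holds (binaryAtom j i i'))
      , from (⋀ᶠ²-sem A ρ σ T T _) (λ i i' → lit-holds (eqAtom i i'))
      , from (⋀ᶠ²-sem A ρ σ T ns _) (λ i X → lit-holds (memAtom i X))
      , ⋀ᴸ-intro A ρ σ L nzs _ λ m → from (⋀ᶠ-sem A ρ σ ns (cntLit m)) λ X → sym (m%n%n≡m%n ∣ σ X ∣ m) )

    diagram-agree : ∀ {B : Model V} {ρ' σ'} → Sat⁺ B ρ' σ' diagram → AgreeOnAtoms A B ρ σ ρ' σ'
    diagram-agree {B} {ρ'} {σ'} p with to (∧⁺-sem₅ B ρ' σ' unaryDiagram binaryDiagram eqDiagram memDiagram cntDiagram) p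
    ... | pᵘ , pᵇ , pᵉ , pᵐ , pᶜ =
      record { rel-agree = rel-agree′ ; eq-agree = eq-agree′ ; mem-agree = mem-agree′ ; cnt-agree = cnt-agree′ }
      where
      lit-agree : ∀ α → Sat⁺ B ρ' σ' (lit α) → Sat A ρ σ α ⇔ Sat B ρ' σ' α
      lit-agree α = literal-agree α (Sat? A ρ σ α)

      rel-agree′ : ∀ R ts → rel A R (map (evalT A ρ) ts) ≡ rel B R (map (evalT B ρ') ts)
      rel-agree′ (inj₁ a) (t ∷ []) with term-surjective t
      ... | i , refl = ⇔→≡ (lit-agree (unaryAtom a i) (to (⋀ᶠ²-sem B ρ' σ' s T _) pᵘ a i))
      rel-agree′ (inj₂ j) (t ∷ t' ∷ []) with term-surjective t | term-surjective t'
      ... | i , refl | i' , refl =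
        ⇔→≡ (lit-agree (binaryAtom j i i') (to (⋀ᶠ²-sem B ρ' σ' T T _) (to (⋀ᶠ-sem B ρ' σ' _ _) pᵇ j) i i'))

      eq-agree′ : ∀ t u → (evalT A ρ t ≡ evalT A ρ u) ⇔ (evalT B ρ' t ≡ evalT B ρ' u)
      eq-agree′ t u with term-surjective t | term-surjective u
      ... | i , refl | i' , refl = lit-agree (eqAtom i i') (to (⋀ᶠ²-sem B ρ' σ' T T _) pᵉ i i')

      mem-agree′ : ∀ t X → (evalT A ρ t ∈ σ X) ⇔ (evalT B ρ' t ∈ σ' X)
      mem-agree′ t X with term-surjective t
      ... | i , refl = lit-agree (memAtom i X) (to (⋀ᶠ²-sem B ρ' σ' T ns _) pᵐ i X)

      cnt-agree′ : ∀ m → m ∈ₗ L → .⦃ _ : NonZero m ⦄ → ∀ X → ∣ σ X ∣ % m ≡ ∣ σ' X ∣ % m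
      cnt-agree′ m m∈L X =
        trans (sym (m%n%n≡m%n ∣ σ X ∣ m)) (sym (to (⋀ᶠ-sem B ρ' σ' ns _) (⋀ᴸ-elim B ρ' σ' L nzs _ pᶜ m∈L) X))

    diagram-bounded : ∀ {r M} → All M L → Bounded r M diagram
    diagram-bounded ML = ∧⁺-bounded₅ unaryDiagram binaryDiagram eqDiagram memDiagram cntDiagram
      (⋀ᶠ²-bounded s T _ λ a i → literal-bounded _ (unaryAtom a i) z≤n tt)
      (⋀ᶠ-bounded _ _ λ j → ⋀ᶠ²-bounded T T _ λ i i' → literal-bounded _ (binaryAtom j i i') z≤n tt)
      (⋀ᶠ²-bounded T T _ λ i i' → literal-bounded _ (eqAtom i i') z≤n tt)
      (⋀ᶠ²-bounded T ns _ λ i X → literal-bounded _ (memAtom i X) z≤n tt)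
      (⋀ᴸ-bounded L nzs _ ML λ m Mm → ⋀ᶠ-bounded ns _ λ X → z≤n , Mm)

  module _ (A : Model V) where
    private
      N : ℕ
      N = size A

    module Extensions (χ : ∀ {nf ns} → (Fin nf → Fin N) → (Fin ns → Subset N) → Formula⁺ V nf ns)
        {nf ns} (ρ : Fin nf → Fin N) (σ : Fin ns → Subset N) where
      unmatchedᵉ : Formula⁺ V (suc nf) ns
      unmatchedᵉ = ⋀ᶠ N λ a → ¬⁺ χ (extend ρ a) σ

      unmatchedˢ : Formula⁺ V nf (suc ns)
      unmatchedˢ = ⋀ˢ N λ S → ¬⁺ χ ρ (extend σ S)

      forthᵉ-χ backᵉ-χ forthˢ-χ backˢ-χ : Formula⁺ V nf ns
      forthᵉ-χ = ⋀ᶠ N λ a → ∃ᵉ⁺ (χ (extend ρ a) σ)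
      backᵉ-χ  = ¬⁺ ∃ᵉ⁺ unmatchedᵉ
      forthˢ-χ = ⋀ˢ N λ S → ∃ˢ⁺ (χ ρ (extend σ S))
      backˢ-χ  = ¬⁺ ∃ˢ⁺ unmatchedˢ

    hintikka : ℕ → ∀ {nf ns} → (Fin nf → Fin N) → (Fin ns → Subset N) → Formula⁺ V nf ns
    hintikka zero    ρ σ = diagram A ρ σ
    hintikka (suc r) ρ σ = diagram A ρ σ ∧⁺ forthᵉ-χ ∧⁺ backᵉ-χ ∧⁺ forthˢ-χ ∧⁺ backˢ-χ
      where open Extensions (hintikka r) ρ σ

    hintikka-holds : ∀ r {nf ns} (ρ : Fin nf → Fin N) (σ : Fin ns → Subset N) → Sat⁺ A ρ σ (hintikka r ρ σ)
    hintikka-holds zero    ρ σ = diagram-holds A ρ σ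
    hintikka-holds (suc r) ρ σ = from (∧⁺-sem₅ A ρ σ (diagram A ρ σ) forthᵉ-χ backᵉ-χ forthˢ-χ backˢ-χ)
      ( diagram-holds A ρ σ
      , from (⋀ᶠ-sem A ρ σ N _) (λ a →
          from (∃ᵉ⁺-sem A ρ σ (hintikka r (extend ρ a) σ)) (a , hintikka-holds r (extend ρ a) σ))
      , from (¬⁺-sem A ρ σ (∃ᵉ⁺ unmatchedᵉ)) (λ h →
          let (a , ¬χs) = to (∃ᵉ⁺-sem A ρ σ unmatchedᵉ) h in
          to (¬⁺-sem A (extend ρ a) σ (hintikka r (extend ρ a) σ))
             (to (⋀ᶠ-sem A (extend ρ a) σ N _) ¬χs a) (hintikka-holds r (extend ρ a) σ))
      , from (⋀ˢ-sem A ρ σ N _) (λ S →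
          from (∃ˢ⁺-sem A ρ σ (hintikka r ρ (extend σ S))) (S , hintikka-holds r ρ (extend σ S)))
      , from (¬⁺-sem A ρ σ (∃ˢ⁺ unmatchedˢ)) (λ h →
          let (S , ¬χs) = to (∃ˢ⁺-sem A ρ σ unmatchedˢ) h in
          to (¬⁺-sem A ρ (extend σ S) (hintikka r ρ (extend σ S)))
             (to (⋀ˢ-sem A ρ (extend σ S) N _) ¬χs S) (hintikka-holds r ρ (extend σ S))) )
      where open Extensions (hintikka r) ρ σ

    hintikka-wins : ∀ r {nf ns} (ρ : Fin nf → Fin N) (σ : Fin ns → Subset N) {B : Model V} {ρ' σ'} →
      Sat⁺ B ρ' σ' (hintikka r ρ σ) → Wins r A B ρ σ ρ' σ'
    hintikka-wins zero    ρ σ p = diagram-agree A ρ σ p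
    hintikka-wins (suc r) ρ σ {B} {ρ'} {σ'} p
      with to (∧⁺-sem₅ B ρ' σ' (diagram A ρ σ) forthᵉ-χ backᵉ-χ forthˢ-χ backˢ-χ) p
      where open Extensions (hintikka r) ρ σ
    ... | p₀ , pᶠᵉ , pᵇᵉ , pᶠˢ , pᵇˢ = record
      { atoms  = diagram-agree A ρ σ p₀
      ; forthᵉ = λ a → let (b , q) = to (∃ᵉ⁺-sem B ρ' σ' (hintikka r (extend ρ a) σ)) (to (⋀ᶠ-sem B ρ' σ' N _) pᶠᵉ a) in
                       b , hintikka-wins r (extend ρ a) σ q
      ; backᵉ  = backᵉ′
      ; forthˢ = λ S → let (T , q) = to (∃ˢ⁺-sem B ρ' σ' (hintikka r ρ (extend σ S))) (to (⋀ˢ-sem B ρ' σ' N _) pᶠˢ S) in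
                       T , hintikka-wins r ρ (extend σ S) q
      ; backˢ  = backˢ′ }
      where
      open Extensions (hintikka r) ρ σ

      -- No element of A matching b would make b a witness of unmatchedᵉ in B.
      backᵉ′ : ∀ b → Σ (Fin N) λ a → Wins r A B (extend ρ a) σ (extend ρ' b) σ'
      backᵉ′ b with any? (λ a → Sat⁺? B (extend ρ' b) σ' (hintikka r (extend ρ a) σ))
      ... | yes (a , q) = a , hintikka-wins r (extend ρ a) σ q
      ... | no ∄a = ⊥-elim (to (¬⁺-sem B ρ' σ' (∃ᵉ⁺ unmatchedᵉ)) pᵇᵉ (from (∃ᵉ⁺-sem B ρ' σ' unmatchedᵉ)
              (b , from (⋀ᶠ-sem B (extend ρ' b) σ' N _) λ a →
                   from (¬⁺-sem B (extend ρ' b) σ' (hintikka r (extend ρ a) σ)) λ q → ∄a (a , q))))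

      backˢ′ : ∀ T → Σ (Subset N) λ S → Wins r A B ρ (extend σ S) ρ' (extend σ' T)
      backˢ′ T with anySubset? (λ S → Sat⁺? B ρ' (extend σ' T) (hintikka r ρ (extend σ S)))
      ... | yes (S , q) = S , hintikka-wins r ρ (extend σ S) q
      ... | no ∄S = ⊥-elim (to (¬⁺-sem B ρ' σ' (∃ˢ⁺ unmatchedˢ)) pᵇˢ (from (∃ˢ⁺-sem B ρ' σ' unmatchedˢ)
              (T , from (⋀ˢ-sem B ρ' (extend σ' T) N _) λ S →
                   from (¬⁺-sem B ρ' (extend σ' T) (hintikka r ρ (extend σ S))) λ q → ∄S (S , q))))

    hintikka-bounded : ∀ r {M} → All M L → ∀ {nf ns} (ρ : Fin nf → Fin N) (σ : Fin ns → Subset N) →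
      Bounded r M (hintikka r ρ σ)
    hintikka-bounded zero    ML ρ σ = diagram-bounded A ρ σ ML
    hintikka-bounded (suc r) ML ρ σ = ∧⁺-bounded₅ (diagram A ρ σ) forthᵉ-χ backᵉ-χ forthˢ-χ backˢ-χ
      (diagram-bounded A ρ σ ML)
      (⋀ᶠ-bounded N _ λ a → ∃ᵉ⁺-bounded _ (hintikka-bounded r ML (extend ρ a) σ))
      (¬⁺-bounded _ (∃ᵉ⁺-bounded unmatchedᵉ (⋀ᶠ-bounded N _ λ a → ¬⁺-bounded _ (hintikka-bounded r ML (extend ρ a) σ))))
      (⋀ˢ-bounded N _ λ S → ∃ˢ⁺-bounded _ (hintikka-bounded r ML ρ (extend σ S)))
      (¬⁺-bounded _ (∃ˢ⁺-bounded unmatchedˢ (⋀ˢ-bounded N _ λ S → ¬⁺-bounded _ (hintikka-bounded r ML ρ (extend σ S)))))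
      where open Extensions (hintikka r) ρ σ

  Equiv⇒Wins : ∀ r {M} {A B : Model V} → Equiv r M A B → All M L →
    {ρA : Fin 0 → Fin (size A)} {σA : Fin 0 → Subset (size A)} {ρB : Fin 0 → Fin (size B)} {σB : Fin 0 → Subset (size B)} →
    Wins r A B ρA σA ρB σB
  Equiv⇒Wins r {M} {A} {B} A≈B ML {ρA} {σA} {ρB} {σB} =
    hintikka-wins A r ρA σA (transfer (hintikka A r ρA σA) (hintikka-holds A r ρA σA) (hintikka-bounded A r ML ρA σA))
    where
    transfer : ∀ x → Sat⁺ A ρA σA x → Bounded r M x → Sat⁺ B ρB σB x
    transfer ⊤⁺    _ _       = tt
    transfer ⌜ φ ⌝ p (q , m) =
      to (Sat-cong B (λ ()) (λ ()) φ) (to (A≈B φ q m) (to (Sat-cong A (λ ()) (λ ()) φ) p))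

%-cong-+ : ∀ {a b c e} d .⦃ _ : NonZero d ⦄ → a % d ≡ b % d → c % d ≡ e % d → (a + c) % d ≡ (b + e) % d
%-cong-+ {a} {b} {c} {e} d a≡b c≡e = begin
  (a + c) % d             ≡⟨ %-distribˡ-+ a c d ⟩
  (a % d + c % d) % d     ≡⟨ cong₂ (λ x y → (x + y) % d) a≡b c≡e ⟩
  (b % d + e % d) % d     ≡⟨ %-distribˡ-+ b e d ⟨
  (b + e) % d             ∎
  where open ≡-Reasoning

-- Adding d - 1 turns 1 + x into x + d, which is x modulo d.
%-cancel-suc : ∀ x y d .⦃ _ : NonZero d ⦄ → suc x % d ≡ suc y % d → x % d ≡ y % d
%-cancel-suc x y d@(suc d-1) 1+x≡1+y = begin
  x % d                   ≡⟨ [m+n]%n≡m%n x d ⟨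
  (x + d) % d             ≡⟨ cong (_% d) (+-suc x d-1) ⟩
  (suc x + d-1) % d       ≡⟨ %-cong-+ {suc x} {suc y} {d-1} {d-1} d 1+x≡1+y refl ⟩
  (suc y + d-1) % d       ≡⟨ cong (_% d) (+-suc y d-1) ⟨
  (y + d) % d             ≡⟨ [m+n]%n≡m%n y d ⟩
  y % d                   ∎
  where open ≡-Reasoning

%-cancelˡ-+ : ∀ c {a b} d .⦃ _ : NonZero d ⦄ → (c + a) % d ≡ (c + b) % d → a % d ≡ b % d
%-cancelˡ-+ zero    d c+a≡c+b = c+a≡c+b
%-cancelˡ-+ (suc c) d c+a≡c+b = %-cancelˡ-+ c d (%-cancel-suc _ _ d c+a≡c+b)

splitΣ-joinΣ : ∀ {E} (k : Fin E → ℕ) e (w : Fin (k e)) → splitΣ k (joinΣ k e w) ≡ (e , w)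
splitΣ-joinΣ {suc E} k zero    w rewrite splitAt-↑ˡ (k zero) w (ΣN E (k ∘ suc)) = refl
splitΣ-joinΣ {suc E} k (suc e) w rewrite splitAt-↑ʳ (k zero) (ΣN E (k ∘ suc)) (joinΣ (k ∘ suc) e w)
  = cong (λ (e' , w') → suc e' , w') (splitΣ-joinΣ (k ∘ suc) e w)

joinΣ-splitΣ : ∀ {E} (k : Fin E → ℕ) c → joinΣ k (proj₁ (splitΣ k c)) (proj₂ (splitΣ k c)) ≡ c
joinΣ-splitΣ {suc E} k c with splitAt (k zero) c in split≡
... | inj₁ w  = splitAt⁻¹-↑ˡ split≡
... | inj₂ c' = trans (cong (k zero ↑ʳ_) (joinΣ-splitΣ (k ∘ suc) c')) (splitAt⁻¹-↑ʳ split≡)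

sum-↑ : ∀ a {b} (f : Fin (a + b) → ℕ) → sum f ≡ sum (f ∘ (_↑ˡ b)) + sum (f ∘ (a ↑ʳ_))
sum-↑ zero    f = refl
sum-↑ (suc a) f = trans (cong (f zero +_) (sum-↑ a (f ∘ suc))) (sym (+-assoc (f zero) _ _))

sum-Σ : ∀ {E} (k : Fin E → ℕ) (f : Fin (ΣN E k) → ℕ) → sum f ≡ sum λ e → sum λ w → f (joinΣ k e w)
sum-Σ {zero}  k f = refl
sum-Σ {suc E} k f = trans (sum-↑ (k zero) f) (cong (sum (f ∘ (_↑ˡ ΣN E (k ∘ suc))) +_) (sum-Σ (k ∘ suc) (f ∘ (k zero ↑ʳ_))))

sum-cong-% : ∀ {E} {f g : Fin E → ℕ} d .⦃ _ : NonZero d ⦄ → (∀ e → f e % d ≡ g e % d) → sum f % d ≡ sum g % d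
sum-cong-% {zero}  d f≡g = refl
sum-cong-% {suc E} d f≡g = %-cong-+ d (f≡g zero) (sum-cong-% d (f≡g ∘ suc))

Fin-empty : ∀ {N} → N ≡ 0 → Fin N → ⊥
Fin-empty refl ()

sum-empty : ∀ {N} (f : Fin N → ℕ) → N ≡ 0 → sum f ≡ 0
sum-empty f refl = refl

nonEmpty? : ∀ N → N ≡ 0 ⊎ Fin N
nonEmpty? zero    = inj₁ refl
nonEmpty? (suc N) = inj₂ zero

Vec-ext : ∀ {A : Set} {n} {xs ys : Vec A n} → lookup xs ≗ lookup ys → xs ≡ ys
Vec-ext {xs = xs} {ys} xs≗ys = trans (sym (tabulate∘lookup xs)) (trans (tabulate-cong xs≗ys) (tabulate∘lookup ys))

∈⇔lookup≡true : ∀ {n} (x : Fin n) (S : Subset n) → x ∈ S ⇔ (lookup S x ≡ true)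
∈⇔lookup≡true x S = mk⇔ []=⇒lookup (lookup⇒[]= x S)

map-injective : ∀ {A B : Set} {f : A → B} → (∀ {x y} → f x ≡ f y → x ≡ y) →
  ∀ {n} {xs ys : Vec A n} → map f xs ≡ map f ys → xs ≡ ys
map-injective f-inj {xs = []}     {[]}     _ = refl
map-injective f-inj {xs = x ∷ xs} {y ∷ ys} p =
  cong₂ _∷_ (f-inj (∷-injectiveˡ p)) (map-injective f-inj (∷-injectiveʳ p))

∃-Vec? : ∀ {N : ℕ} l {Q : Vec (Fin N) l → Set} → (∀ us → Dec (Q us)) → Dec (Σ (Vec (Fin N) l) Q)
∃-Vec? zero Q? with Q? []
... | yes q = yes ([] , q)
... | no ¬q = no λ { ([] , q) → ¬q q }
∃-Vec? (suc l) Q? with any? (λ u → ∃-Vec? l (λ us → Q? (u ∷ us)))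
... | yes (u , us , q) = yes (u ∷ us , q)
... | no ¬q = no λ { (u ∷ us , q) → ¬q (u , us , q) }

⌊⌋≡true⇔ : ∀ {Q : Set} (d : Dec Q) → (⌊ d ⌋ ≡ true) ⇔ Q
⌊⌋≡true⇔ (yes q) = mk⇔ (λ _ → q) (λ _ → refl)
⌊⌋≡true⇔ (no ¬q) = mk⇔ (λ ()) (⊥-elim ∘ ¬q)

↑ˡ≢↑ʳ : ∀ {a b} (i : Fin a) (j : Fin b) → i ↑ˡ b ≡ a ↑ʳ j → ⊥
↑ˡ≢↑ʳ {a} {b} i j p with trans (sym (splitAt-↑ˡ a i b)) (trans (cong (splitAt a) p) (splitAt-↑ʳ a b j))
... | ()

↑-cases : ∀ a {b} (x : Fin (a + b)) → (Σ (Fin a) λ i → x ≡ i ↑ˡ b) ⊎ (Σ (Fin b) λ j → x ≡ a ↑ʳ j)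
↑-cases a x with splitAt a x in split≡
... | inj₁ i = inj₁ (i , sym (splitAt⁻¹-↑ˡ split≡))
... | inj₂ j = inj₂ (j , sym (splitAt⁻¹-↑ʳ split≡))

-- Gluing models along a hypergraph

-- Component e is glued in by identifying its j-th source with the vertex att e j of a hypergraph with n sources
-- and P inner vertices.
module Gluing {s : ℕ} (ar : Fin s → ℕ) {n P E : ℕ} (k : Fin E → ℕ)
    (att : (e : Fin E) → Fin (k e) → Vtx n P) (att-injective : ∀ e → Injective _≡_ _≡_ (att e)) where

  Relᴳ : Set
  Relᴳ = Fin s ⊎ Fin (maxAr ar)

  arityᴳ : Relᴳ → ℕ
  arityᴳ = [ (λ _ → 1) , (λ _ → 2) ]

  vtx : Vtx n P → Fin (n + P)
  vtx = join n P

  vtx-injective : ∀ {x y} → vtx x ≡ vtx y → x ≡ y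
  vtx-injective {x} {y} p = trans (sym (splitAt-join n P x)) (trans (cong (splitAt n) p) (splitAt-join n P y))

  -- A model over Fin (m + rest) whose i-th constant is i ↑ˡ rest.
  record SourcesFirst (m : ℕ) : Set where
    field
      rest : ℕ
      relˢ : (R : Relᴳ) → Vec (Fin (m + rest)) (arityᴳ R) → Bool
  open SourcesFirst public

  toModel : ∀ {m} → SourcesFirst m → Model (VocΣ ar m)
  toModel C = record { size = _ ; rel = relˢ C ; const = _↑ˡ rest C }

  headᴳ : ∀ {A : Set} R → Vec A (arityᴳ R) → A
  headᴳ (inj₁ _) (u ∷ _) = u
  headᴳ (inj₂ _) (u ∷ _) = u

  Components : Set
  Components = (e : Fin E) → SourcesFirst (k e)

  module Glued (C : Components) where

    restOf : Fin E → ℕ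
    restOf e = rest (C e)

    Nᴳ : ℕ
    Nᴳ = (n + P) + ΣN E restOf

    vertex : Fin (n + P) → Fin Nᴳ
    vertex v = v ↑ˡ ΣN E restOf

    interior : (e : Fin E) → Fin (restOf e) → Fin Nᴳ
    interior e t = (n + P) ↑ʳ joinΣ restOf e t

    embed : (e : Fin E) → Fin (k e + restOf e) → Fin Nᴳ
    embed e u = [ vertex ∘ vtx ∘ att e , interior e ] (splitAt (k e) u)

    Related : (R : Relᴳ) → Vec (Fin Nᴳ) (arityᴳ R) → Set
    Related R xs = Σ (Fin E) λ e → Σ (Vec (Fin (k e + restOf e)) (arityᴳ R)) λ us →
                   map (embed e) us ≡ xs × relˢ (C e) R us ≡ true

    related? : ∀ R xs → Dec (Related R xs)
    related? R xs = any? λ e → ∃-Vec? (arityᴳ R) λ us → ≡-dec _≟ᶠ_ (map (embed e) us) xs ×-dec (relˢ (C e) R us ≟ᵇ true)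

    glued : Model (VocΣ ar n)
    glued = record
      { size  = Nᴳ
      ; rel   = λ R xs → ⌊ related? R xs ⌋
      ; const = λ c → vertex (c ↑ˡ P) }

    rel-glued : ∀ R xs → (rel glued R xs ≡ true) ⇔ Related R xs
    rel-glued R xs = ⌊⌋≡true⇔ (related? R xs)

    element-cases : ∀ x → (Σ (Fin (n + P)) λ v → x ≡ vertex v) ⊎
                          (Σ (Fin E) λ e → Σ (Fin (restOf e)) λ t → x ≡ interior e t)
    element-cases x with ↑-cases (n + P) x
    ... | inj₁ (v , x≡v) = inj₁ (v , x≡v)
    ... | inj₂ (c , x≡c) = inj₂ (proj₁ (splitΣ restOf c) , proj₂ (splitΣ restOf c) ,
                                 trans x≡c (cong ((n + P) ↑ʳ_) (sym (joinΣ-splitΣ restOf c))))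

    vertex-injective : ∀ {v w} → vertex v ≡ vertex w → v ≡ w
    vertex-injective = ↑ˡ-injective _ _ _

    vertex≢interior : ∀ {v e t} → vertex v ≡ interior e t → ⊥
    vertex≢interior = ↑ˡ≢↑ʳ _ _

    interior-injective : ∀ {e t e' t'} → interior e t ≡ interior e' t' →
      _≡_ {A = Σ (Fin E) (Fin ∘ restOf)} (e , t) (e' , t')
    interior-injective {e} {t} {e'} {t'} p = trans (sym (splitΣ-joinΣ restOf e t))
      (trans (cong (splitΣ restOf) (↑ʳ-injective (n + P) _ _ p)) (splitΣ-joinΣ restOf e' t'))

    embed-source : ∀ e j → embed e (j ↑ˡ restOf e) ≡ vertex (vtx (att e j))
    embed-source e j rewrite splitAt-↑ˡ (k e) j (restOf e) = refl

    embed-interior : ∀ e t → embed e (k e ↑ʳ t) ≡ interior e t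
    embed-interior e t rewrite splitAt-↑ʳ (k e) (restOf e) t = refl

    embed-injective : ∀ e {u u'} → embed e u ≡ embed e u' → u ≡ u'
    embed-injective e {u} {u'} p with ↑-cases (k e) u | ↑-cases (k e) u'
    ... | inj₁ (j , refl) | inj₁ (j' , refl) = cong (_↑ˡ restOf e) (att-injective e (vtx-injective
          (vertex-injective (trans (sym (embed-source e j)) (trans p (embed-source e j'))))))
    ... | inj₁ (j , refl) | inj₂ (t' , refl) =
          ⊥-elim (vertex≢interior (trans (sym (embed-source e j)) (trans p (embed-interior e t'))))
    ... | inj₂ (t , refl) | inj₁ (j' , refl) =
          ⊥-elim (vertex≢interior (trans (sym (embed-source e j')) (trans (sym p) (embed-interior e t))))
    ... | inj₂ (t , refl) | inj₂ (t' , refl)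
          with interior-injective (trans (sym (embed-interior e t)) (trans p (embed-interior e t')))
    ...   | refl = refl

    embed⁻¹-vertex : ∀ e u v → embed e u ≡ vertex v → Σ (Fin (k e)) λ j → u ≡ j ↑ˡ restOf e × vtx (att e j) ≡ v
    embed⁻¹-vertex e u v p with ↑-cases (k e) u
    ... | inj₁ (j , refl) = j , refl , vertex-injective (trans (sym (embed-source e j)) p)
    ... | inj₂ (t , refl) = ⊥-elim (vertex≢interior (trans (sym p) (embed-interior e t)))

    InImage : Fin E → Fin Nᴳ → Set
    InImage e x = Σ (Fin (k e + restOf e)) λ u → embed e u ≡ x

    InImage-vertex : ∀ e v → InImage e (vertex v) ⇔ (Σ (Fin (k e)) λ j → vtx (att e j) ≡ v)
    InImage-vertex e v = mk⇔
      (λ (u , p) → let (j , _ , q) = embed⁻¹-vertex e u v p in j , q)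
      (λ (j , q) → j ↑ˡ restOf e , trans (embed-source e j) (cong vertex q))

    InImage-interior : ∀ e e' t → InImage e (interior e' t) ⇔ (e ≡ e')
    InImage-interior e e' t = mk⇔ from-image (λ { refl → k e ↑ʳ t , embed-interior e t })
      where
      from-image : InImage e (interior e' t) → e ≡ e'
      from-image (u , p) with ↑-cases (k e) u
      ... | inj₁ (j , refl) = ⊥-elim (vertex≢interior (trans (sym (embed-source e j)) p))
      ... | inj₂ (t₀ , refl) = cong proj₁ (interior-injective (trans (sym (embed-interior e t₀)) p))

    restrict : (e : Fin E) → Subset Nᴳ → Subset (k e + restOf e)
    restrict e S = tabulate (lookup S ∘ embed e)

    ∈-restrict : ∀ e S {u x} → embed e u ≡ x → u ∈ restrict e S ⇔ x ∈ S
    ∈-restrict e S {u} refl = mk⇔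
      (λ p → lookup⇒[]= _ S (trans (sym (lookup∘tabulate _ u)) ([]=⇒lookup p)))
      (λ p → lookup⇒[]= u _ (trans (lookup∘tabulate _ u) ([]=⇒lookup p)))

    ∣S∣-glued : ∀ S → ∣ S ∣ ≡ sum (λ v → bit (lookup S (vertex v))) + sum λ e → sum λ t → bit (lookup S (interior e t))
    ∣S∣-glued S = trans (∣S∣≡sum S) (trans (sum-↑ (n + P) _) (cong (sum (λ v → bit (lookup S (vertex v))) +_) (sum-Σ restOf _)))

    ∣restrict∣ : ∀ e S → ∣ restrict e S ∣ ≡
      sum (λ j → bit (lookup S (vertex (vtx (att e j))))) + sum (λ t → bit (lookup S (interior e t)))
    ∣restrict∣ e S = trans (∣S∣≡sum (restrict e S)) (trans (sum-↑ (k e) _)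
      (cong₂ _+_ (sum-cong-≗ λ j → cong bit (trans (lookup∘tabulate _ (j ↑ˡ restOf e)) (cong (lookup S) (embed-source e j))))
                 (sum-cong-≗ λ t → cong bit (trans (lookup∘tabulate _ (k e ↑ʳ t)) (cong (lookup S) (embed-interior e t))))))

-- Composing the winning strategies of the components

module Composition {s : ℕ} (ar : Fin s → ℕ) {n P E : ℕ} (k : Fin E → ℕ)
    (att : (e : Fin E) → Fin (k e) → Vtx n P) (att-injective : ∀ e → Injective _≡_ _≡_ (att e)) (L : List ℕ) where

  open Gluing ar k att att-injective
  open Game L

  module Positions (CA CB : Components) where
    module GA = Glued CA
    module GB = Glued CB

    MA MB : (e : Fin E) → Model (VocΣ ar (k e))
    MA e = toModel (CA e)
    MB e = toModel (CB e)

    module _ (r : ℕ) {nf ns : ℕ} (ρA : Fin nf → Fin GA.Nᴳ) (σA : Fin ns → Subset GA.Nᴳ)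
             (ρB : Fin nf → Fin GB.Nᴳ) (σB : Fin ns → Subset GB.Nᴳ) where

      -- The play inside component e: local names for the pebbles that lie in it.
      record LocalPlay (e : Fin E) : Set where
        field
          ρAₑ    : Fin nf → Fin (k e + GA.restOf e)
          ρBₑ    : Fin nf → Fin (k e + GB.restOf e)
          wins   : Wins r (MA e) (MB e) ρAₑ (GA.restrict e ∘ σA) ρBₑ (GB.restrict e ∘ σB)
          liftsA : ∀ i → GA.InImage e (ρA i) → GA.embed e (ρAₑ i) ≡ ρA i
          liftsB : ∀ i → GB.InImage e (ρB i) → GB.embed e (ρBₑ i) ≡ ρB i

      -- An empty component admits no local assignment when nf > 0.
      LocalState : Fin E → Set
      LocalState e = (k e + GA.restOf e ≡ 0 × k e + GB.restOf e ≡ 0) ⊎ LocalPlay e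

      record Invariant : Set where
        field
          same-vertex      : ∀ i v → (ρA i ≡ GA.vertex v) ⇔ (ρB i ≡ GB.vertex v)
          same-image       : ∀ i e → GA.InImage e (ρA i) ⇔ GB.InImage e (ρB i)
          same-on-vertices : ∀ X v → lookup (σA X) (GA.vertex v) ≡ lookup (σB X) (GB.vertex v)
          local            : ∀ e → LocalState e

  open Positions public using (Invariant; LocalPlay; LocalState)
  open Invariant public
  open LocalPlay public

  Invariant-sym : ∀ {CA CB r nf ns} {ρA : Fin nf → Fin (Glued.Nᴳ CA)} {σA : Fin ns → Subset (Glued.Nᴳ CA)}
    {ρB : Fin nf → Fin (Glued.Nᴳ CB)} {σB : Fin ns → Subset (Glued.Nᴳ CB)} →
    Invariant CA CB r ρA σA ρB σB → Invariant CB CA r ρB σB ρA σA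
  Invariant-sym {CA} {CB} {r} {ρA = ρA} {σA} {ρB} {σB} I = record
    { same-vertex      = λ i v → ⇔-sym (same-vertex I i v)
    ; same-image       = λ i e → ⇔-sym (same-image I i e)
    ; same-on-vertices = λ X v → sym (same-on-vertices I X v)
    ; local            = λ e → swap (local I e) }
    where
    swap : ∀ {e} → LocalState CA CB r ρA σA ρB σB e → LocalState CB CA r ρB σB ρA σA e
    swap (inj₁ (emptyA , emptyB)) = inj₁ (emptyB , emptyA)
    swap (inj₂ lp) = inj₂ (record { ρAₑ = ρBₑ lp ; ρBₑ = ρAₑ lp ; wins = Wins-sym r (wins lp)
                                  ; liftsA = liftsB lp ; liftsB = liftsA lp })

  module Atoms {CA CB : Components} {r nf ns} {ρA : Fin nf → Fin (Glued.Nᴳ CA)} {σA : Fin ns → Subset (Glued.Nᴳ CA)}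
      {ρB : Fin nf → Fin (Glued.Nᴳ CB)} {σB : Fin ns → Subset (Glued.Nᴳ CB)}
      (I : Invariant CA CB r ρA σA ρB σB) where
    open Positions CA CB using (module GA; module GB; MA; MB)

    evA : Term (VocΣ ar n) nf → Fin GA.Nᴳ
    evA = evalT GA.glued ρA

    evB : Term (VocΣ ar n) nf → Fin GB.Nᴳ
    evB = evalT GB.glued ρB

    play : ∀ e → Fin (k e + GA.restOf e) → LocalPlay CA CB r ρA σA ρB σB e
    play e u with local I e
    ... | inj₁ (emptyA , _) = ⊥-elim (Fin-empty emptyA u)
    ... | inj₂ lp = lp

    same-vertexᵗ : ∀ τ v → (evA τ ≡ GA.vertex v) ⇔ (evB τ ≡ GB.vertex v)
    same-vertexᵗ (var i) v = same-vertex I i v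
    same-vertexᵗ (con c) v = mk⇔ (cong GB.vertex ∘ GA.vertex-injective) (cong GA.vertex ∘ GB.vertex-injective)

    localTerm : ∀ {e} (lp : LocalPlay CA CB r ρA σA ρB σB e) τ → GA.InImage e (evA τ) →
      Σ (Term (VocΣ ar (k e)) nf) λ τₑ →
        GA.embed e (evalT (MA e) (ρAₑ lp) τₑ) ≡ evA τ × GB.embed e (evalT (MB e) (ρBₑ lp) τₑ) ≡ evB τ
    localTerm lp (var i) h = var i , liftsA lp i h , liftsB lp i (to (same-image I i _) h)
    localTerm {e} lp (con c) h =
      let (j , q) = to (GA.InImage-vertex e (c ↑ˡ P)) h in
      con j , trans (GA.embed-source e j) (cong GA.vertex q) , trans (GB.embed-source e j) (cong GB.vertex q)

    localTerms : ∀ {e l} (lp : LocalPlay CA CB r ρA σA ρB σB e) (ts : Vec (Term (VocΣ ar n) nf) l) us →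
      map (GA.embed e) us ≡ map evA ts →
      Σ (Vec (Term (VocΣ ar (k e)) nf) l) λ τₑs →
        us ≡ map (evalT (MA e) (ρAₑ lp)) τₑs × map (GB.embed e) (map (evalT (MB e) (ρBₑ lp)) τₑs) ≡ map evB ts
    localTerms lp [] [] _ = [] , refl , refl
    localTerms {e} lp (t ∷ ts) (u ∷ us) p =
      let (u≡t , us≡ts) = ∷-injective p
          (τₑ , τA , τB) = localTerm lp t (u , u≡t)
          (τₑs , us≡ , τsB) = localTerms lp ts us us≡ts
      in τₑ ∷ τₑs , cong₂ _∷_ (GA.embed-injective e (trans u≡t (sym τA))) us≡ , cong₂ _∷_ τB τsB

    eq⇒ : ∀ τ υ → evA τ ≡ evA υ → evB τ ≡ evB υ
    eq⇒ τ υ τ≡υ with GA.element-cases (evA τ)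
    ... | inj₁ (v , τ≡v) = trans (to (same-vertexᵗ τ v) τ≡v) (sym (to (same-vertexᵗ υ v) (trans (sym τ≡υ) τ≡v)))
    ... | inj₂ (e , t , τ≡t) =
      let lp = play e (k e ↑ʳ t)
          hτ = k e ↑ʳ t , trans (GA.embed-interior e t) (sym τ≡t)
          (τₑ , τA , τB) = localTerm lp τ hτ
          (υₑ , υA , υB) = localTerm lp υ (proj₁ hτ , trans (proj₂ hτ) τ≡υ)
          τₑ≡υₑ = GA.embed-injective e (trans τA (trans τ≡υ (sym υA)))
      in trans (sym τB) (trans (cong (GB.embed e) (to (eq-agree (Wins-atoms r (wins lp)) τₑ υₑ) τₑ≡υₑ)) υB)

    mem⇒ : ∀ τ X → evA τ ∈ σA X → evB τ ∈ σB X
    mem⇒ τ X τ∈X with GA.element-cases (evA τ)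
    ... | inj₁ (v , τ≡v) = lookup⇒[]= _ _ (begin
      lookup (σB X) (evB τ)       ≡⟨ cong (lookup (σB X)) (to (same-vertexᵗ τ v) τ≡v) ⟩
      lookup (σB X) (GB.vertex v) ≡⟨ same-on-vertices I X v ⟨
      lookup (σA X) (GA.vertex v) ≡⟨ cong (lookup (σA X)) τ≡v ⟨
      lookup (σA X) (evA τ)       ≡⟨ []=⇒lookup τ∈X ⟩
      true                        ∎)
      where open ≡-Reasoning
    ... | inj₂ (e , t , τ≡t) =
      let lp = play e (k e ↑ʳ t)
          (τₑ , τA , τB) = localTerm lp τ (k e ↑ʳ t , trans (GA.embed-interior e t) (sym τ≡t))
      in to (GB.∈-restrict e (σB X) τB)
            (to (mem-agree (Wins-atoms r (wins lp)) τₑ X) (from (GA.∈-restrict e (σA X) τA) τ∈X))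

    rel⇒ : ∀ R ts → GA.Related R (map evA ts) → GB.Related R (map evB ts)
    rel⇒ R ts (e , us , us↦ts , Rus) =
      let lp = play e (headᴳ R us)
          (τₑs , us≡ , τsB) = localTerms lp ts us us↦ts
      in e , _ , τsB ,
         trans (sym (rel-agree (Wins-atoms r (wins lp)) R τₑs)) (trans (cong (relˢ (CA e) R) (sym us≡)) Rus)

    cnt-agree′ : ∀ m → m ∈ₗ L → .⦃ _ : NonZero m ⦄ → ∀ X → ∣ σA X ∣ % m ≡ ∣ σB X ∣ % m
    cnt-agree′ m m∈L X = begin
      ∣ σA X ∣ % m                                 ≡⟨ cong (_% m) (GA.∣S∣-glued (σA X)) ⟩
      (sum (bitA ∘ GA.vertex) + sum interiorA) % m ≡⟨ %-cong-+ m (cong (_% m) (sum-cong-≗ (cong bit ∘ same-on-vertices I X)))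
                                                                 (sum-cong-% m interior-agree) ⟩
      (sum (bitB ∘ GB.vertex) + sum interiorB) % m ≡⟨ cong (_% m) (GB.∣S∣-glued (σB X)) ⟨
      ∣ σB X ∣ % m                                 ∎
      where
      open ≡-Reasoning
      bitA : Fin GA.Nᴳ → ℕ
      bitA = bit ∘ lookup (σA X)
      bitB : Fin GB.Nᴳ → ℕ
      bitB = bit ∘ lookup (σB X)
      interiorA interiorB : Fin E → ℕ
      interiorA e = sum (bitA ∘ GA.interior e)
      interiorB e = sum (bitB ∘ GB.interior e)
      sourcesA sourcesB : Fin E → ℕ
      sourcesA e = sum (bitA ∘ GA.vertex ∘ vtx ∘ att e)
      sourcesB e = sum (bitB ∘ GB.vertex ∘ vtx ∘ att e)

      -- The interior of a component is its restriction minus its sources, which agree on both sides.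
      interior-agree : ∀ e → interiorA e % m ≡ interiorB e % m
      interior-agree e with local I e
      ... | inj₁ (emptyA , emptyB) =
        trans (cong (_% m) (sum-empty _ (m+n≡0⇒n≡0 (k e) emptyA))) (cong (_% m) (sym (sum-empty _ (m+n≡0⇒n≡0 (k e) emptyB))))
      ... | inj₂ lp = %-cancelˡ-+ (sourcesB e) m (begin
        (sourcesB e + interiorA e) % m     ≡⟨ cong (λ c → (c + interiorA e) % m)
                                               (sum-cong-≗ λ j → cong bit (same-on-vertices I X (vtx (att e j)))) ⟨
        (sourcesA e + interiorA e) % m     ≡⟨ cong (_% m) (GA.∣restrict∣ e (σA X)) ⟨
        ∣ GA.restrict e (σA X) ∣ % m       ≡⟨ cnt-agree (Wins-atoms r (wins lp)) m m∈L X ⟩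
        ∣ GB.restrict e (σB X) ∣ % m       ≡⟨ cong (_% m) (GB.∣restrict∣ e (σB X)) ⟩
        (sourcesB e + interiorB e) % m     ∎)

  Invariant⇒AgreeOnAtoms : ∀ {CA CB r nf ns} {ρA : Fin nf → Fin (Glued.Nᴳ CA)} {σA : Fin ns → Subset (Glued.Nᴳ CA)}
    {ρB : Fin nf → Fin (Glued.Nᴳ CB)} {σB : Fin ns → Subset (Glued.Nᴳ CB)} →
    Invariant CA CB r ρA σA ρB σB → AgreeOnAtoms (Glued.glued CA) (Glued.glued CB) ρA σA ρB σB
  Invariant⇒AgreeOnAtoms {CA} {CB} {ρA = ρA} {ρB = ρB} I = record
    { rel-agree = λ R ts → ⇔→≡ (⇔-trans (GA.rel-glued R _)
                    (⇔-trans (mk⇔ (rel⇒ I R ts) (rel⇒ (Invariant-sym I) R ts)) (⇔-sym (GB.rel-glued R _))))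
    ; eq-agree  = λ τ υ → mk⇔ (eq⇒ I τ υ) (eq⇒ (Invariant-sym I) τ υ)
    ; mem-agree = λ τ X → mk⇔ (mem⇒ I τ X) (mem⇒ (Invariant-sym I) τ X)
    ; cnt-agree = cnt-agree′ I }
    where
    open Atoms using (rel⇒; eq⇒; mem⇒; cnt-agree′)
    module GA = Glued CA
    module GB = Glued CB

  module ElementMove {CA CB : Components} {r nf ns} {ρA : Fin nf → Fin (Glued.Nᴳ CA)} {σA : Fin ns → Subset (Glued.Nᴳ CA)}
      {ρB : Fin nf → Fin (Glued.Nᴳ CB)} {σB : Fin ns → Subset (Glued.Nᴳ CB)}
      (I : Invariant CA CB (suc r) ρA σA ρB σB) (a : Fin (Glued.Nᴳ CA)) where
    open Positions CA CB using (module GA; module GB; MA; MB)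

    record Response (e : Fin E) : Set where
      field
        play    : LocalPlay CA CB (suc r) ρA σA ρB σB e
        aₑ      : Fin (k e + GA.restOf e)
        lifts-a : GA.InImage e a → GA.embed e aₑ ≡ a

      bₑ : Fin (k e + GB.restOf e)
      bₑ = proj₁ (forthᵉ (wins play) aₑ)

      winsₑ : Wins r (MA e) (MB e) (extend (ρAₑ play) aₑ) (GA.restrict e ∘ σA) (extend (ρBₑ play) bₑ) (GB.restrict e ∘ σB)
      winsₑ = proj₂ (forthᵉ (wins play) aₑ)

      source-kept : ∀ j → aₑ ≡ j ↑ˡ GA.restOf e → bₑ ≡ j ↑ˡ GB.restOf e
      source-kept j = to (eq-agree (Wins-atoms r winsₑ) (var zero) (con j))

      interior-kept : ∀ t → aₑ ≡ k e ↑ʳ t → Σ (Fin (GB.restOf e)) λ t' → bₑ ≡ k e ↑ʳ t'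
      interior-kept t aₑ≡t with ↑-cases (k e) bₑ
      ... | inj₁ (j , bₑ≡j) =
        ⊥-elim (↑ˡ≢↑ʳ j t (trans (sym (from (eq-agree (Wins-atoms r winsₑ) (var zero) (con j)) bₑ≡j)) aₑ≡t))
      ... | inj₂ (t' , bₑ≡t') = t' , bₑ≡t'
    open Response

    -- Pebble a in the component if possible, anywhere in it otherwise; only a component empty on both sides stays unplayed.
    respond : ∀ e → (k e + GA.restOf e ≡ 0 × k e + GB.restOf e ≡ 0) ⊎ Response e
    respond e with local I e
    ... | inj₁ empty = inj₁ empty
    ... | inj₂ lp with any? (λ u → GA.embed e u ≟ᶠ a)
    ...   | yes (u , u↦a) = inj₂ (record { play = lp ; aₑ = u ; lifts-a = λ _ → u↦a })
    ...   | no ∄u with nonEmpty? (k e + GA.restOf e)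
    ...     | inj₂ u₀ = inj₂ (record { play = lp ; aₑ = u₀ ; lifts-a = ⊥-elim ∘ ∄u })
    ...     | inj₁ emptyA with nonEmpty? (k e + GB.restOf e)
    ...       | inj₁ emptyB = inj₁ (emptyA , emptyB)
    ...       | inj₂ b₀ = ⊥-elim (Fin-empty emptyA (proj₁ (backᵉ (wins lp) b₀)))

    LiftsB : Fin E → Fin GB.Nᴳ → Set
    LiftsB e b = ∀ {y} → respond e ≡ inj₂ y → GB.InImage e b → GB.embed e (bₑ y) ≡ b

    next-local : ∀ {b} e → LiftsB e b → LocalState CA CB r (extend ρA a) σA (extend ρB b) σB e
    next-local e lifts-b with respond e
    ... | inj₁ empty = inj₁ empty
    ... | inj₂ y = inj₂ (record
      { ρAₑ = extend (ρAₑ (play y)) (aₑ y) ; ρBₑ = extend (ρBₑ (play y)) (bₑ y) ; wins = winsₑ y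
      ; liftsA = λ { zero → lifts-a y ; (suc i) → liftsA (play y) i }
      ; liftsB = λ { zero → lifts-b refl ; (suc i) → liftsB (play y) i } })

    next : ∀ {b} → (∀ w → (a ≡ GA.vertex w) ⇔ (b ≡ GB.vertex w)) → (∀ e → GA.InImage e a ⇔ GB.InImage e b) →
      (∀ e → LiftsB e b) → Invariant CA CB r (extend ρA a) σA (extend ρB b) σB
    next same-vertex₀ same-image₀ lifts-b = record
      { same-vertex      = λ { zero → same-vertex₀ ; (suc i) → same-vertex I i }
      ; same-image       = λ { zero → same-image₀ ; (suc i) → same-image I i }
      ; same-on-vertices = same-on-vertices I
      ; local            = λ e → next-local e (lifts-b e) }

    forthᵉ′ : Σ (Fin GB.Nᴳ) λ b → Invariant CA CB r (extend ρA a) σA (extend ρB b) σB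
    forthᵉ′ with GA.element-cases a
    ... | inj₁ (v , refl) = GB.vertex v , next
      (λ w → mk⇔ (cong GB.vertex ∘ GA.vertex-injective) (cong GA.vertex ∘ GB.vertex-injective))
      (λ e → ⇔-trans (GA.InImage-vertex e v) (⇔-sym (GB.InImage-vertex e v)))
      lifts-vertex
      where
      lifts-vertex : ∀ e → LiftsB e (GB.vertex v)
      lifts-vertex e {y} _ hB =
        let (j , j↦v) = to (GB.InImage-vertex e v) hB
            (j' , aₑ≡j' , j'↦v) = GA.embed⁻¹-vertex e (aₑ y) v (lifts-a y (from (GA.InImage-vertex e v) (j , j↦v)))
        in trans (cong (GB.embed e) (source-kept y j' aₑ≡j')) (trans (GB.embed-source e j') (cong GB.vertex j'↦v))
    ... | inj₂ (e₀ , t , refl) with respond e₀ in resp≡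
    ...   | inj₁ (emptyA , _) = ⊥-elim (Fin-empty emptyA (k e₀ ↑ʳ t))
    ...   | inj₂ y₀ = GB.interior e₀ t' , next
      (λ w → mk⇔ (⊥-elim ∘ GA.vertex≢interior ∘ sym) (⊥-elim ∘ GB.vertex≢interior ∘ sym))
      (λ e → ⇔-trans (GA.InImage-interior e e₀ t) (⇔-sym (GB.InImage-interior e e₀ t')))
      lifts-interior
      where
      aₑ≡t : aₑ y₀ ≡ k e₀ ↑ʳ t
      aₑ≡t = GA.embed-injective e₀ (trans (lifts-a y₀ (k e₀ ↑ʳ t , GA.embed-interior e₀ t)) (sym (GA.embed-interior e₀ t)))
      t' : Fin (GB.restOf e₀)
      t' = proj₁ (interior-kept y₀ t aₑ≡t)
      lifts-interior : ∀ e → LiftsB e (GB.interior e₀ t')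
      lifts-interior e resp≡' hB with to (GB.InImage-interior e e₀ t') hB
      ... | refl with trans (sym resp≡') resp≡
      ...   | refl = trans (cong (GB.embed e₀) (proj₂ (interior-kept y₀ t aₑ≡t))) (GB.embed-interior e₀ t')

  module SetMove {CA CB : Components} {r nf ns} {ρA : Fin nf → Fin (Glued.Nᴳ CA)} {σA : Fin ns → Subset (Glued.Nᴳ CA)}
      {ρB : Fin nf → Fin (Glued.Nᴳ CB)} {σB : Fin ns → Subset (Glued.Nᴳ CB)}
      (I : Invariant CA CB (suc r) ρA σA ρB σB) (S : Subset (Glued.Nᴳ CA)) where
    open Positions CA CB using (module GA; module GB; MA; MB)

    localAnswer : ∀ {e} (lp : LocalPlay CA CB (suc r) ρA σA ρB σB e) → Σ (Subset (k e + GB.restOf e)) λ Tₑ →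
      Wins r (MA e) (MB e) (ρAₑ lp) (extend (GA.restrict e ∘ σA) (GA.restrict e S)) (ρBₑ lp) (extend (GB.restrict e ∘ σB) Tₑ)
    localAnswer {e} lp = forthˢ (wins lp) (GA.restrict e S)

    interiorAnswer : ∀ {e} → LocalState CA CB (suc r) ρA σA ρB σB e → Fin (GB.restOf e) → Bool
    interiorAnswer (inj₁ _)  t = false
    interiorAnswer {e} (inj₂ lp) t = lookup (proj₁ (localAnswer lp)) (k e ↑ʳ t)

    -- Copy S on the shared vertices and each local answer on the interior of its component.
    colour : Fin GB.Nᴳ → Bool
    colour x = [ lookup S ∘ GA.vertex , (λ c → interiorAnswer (local I (proj₁ (splitΣ GB.restOf c))) (proj₂ (splitΣ GB.restOf c))) ]
               (splitAt (n + P) x)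

    T : Subset GB.Nᴳ
    T = tabulate colour

    T-vertex : ∀ v → lookup T (GB.vertex v) ≡ lookup S (GA.vertex v)
    T-vertex v = trans (lookup∘tabulate colour (GB.vertex v))
      (cong [ lookup S ∘ GA.vertex , _ ] (splitAt-↑ˡ (n + P) v (ΣN E GB.restOf)))

    T-interior : ∀ e t → lookup T (GB.interior e t) ≡ interiorAnswer (local I e) t
    T-interior e t = trans (lookup∘tabulate colour (GB.interior e t))
      (trans (cong [ _ , _ ] (splitAt-↑ʳ (n + P) (ΣN E GB.restOf) (joinΣ GB.restOf e t)))
             (cong (λ (e , t) → interiorAnswer (local I e) t) (splitΣ-joinΣ GB.restOf e t)))

    answer≡restrict : ∀ e lp → local I e ≡ inj₂ lp → proj₁ (localAnswer lp) ≡ GB.restrict e T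
    answer≡restrict e lp local≡ = Vec-ext λ u → answer-at u (↑-cases (k e) u)
      where
      answer-at : ∀ u → _ → lookup (proj₁ (localAnswer lp)) u ≡ lookup (GB.restrict e T) u
      answer-at u (inj₁ (j , refl)) = begin
        lookup (proj₁ (localAnswer lp)) (j ↑ˡ _)  ≡⟨ ⇔→≡ (⇔-trans (⇔-sym (∈⇔lookup≡true _ _))
                                                      (⇔-trans (mem-agree (Wins-atoms r (proj₂ (localAnswer lp))) (con j) zero)
                                                               (∈⇔lookup≡true _ _))) ⟨
        lookup (GA.restrict e S) (j ↑ˡ _)         ≡⟨ lookup∘tabulate _ (j ↑ˡ _) ⟩
        lookup S (GA.embed e (j ↑ˡ _))            ≡⟨ cong (lookup S) (GA.embed-source e j) ⟩
        lookup S (GA.vertex (vtx (att e j)))      ≡⟨ T-vertex (vtx (att e j)) ⟨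
        lookup T (GB.vertex (vtx (att e j)))      ≡⟨ cong (lookup T) (GB.embed-source e j) ⟨
        lookup T (GB.embed e (j ↑ˡ _))            ≡⟨ lookup∘tabulate _ (j ↑ˡ _) ⟨
        lookup (GB.restrict e T) (j ↑ˡ _)         ∎
        where open ≡-Reasoning
      answer-at u (inj₂ (t , refl)) = begin
        lookup (proj₁ (localAnswer lp)) (k e ↑ʳ t) ≡⟨ cong (λ st → interiorAnswer st t) local≡ ⟨
        interiorAnswer (local I e) t               ≡⟨ T-interior e t ⟨
        lookup T (GB.interior e t)                 ≡⟨ cong (lookup T) (GB.embed-interior e t) ⟨
        lookup T (GB.embed e (k e ↑ʳ t))           ≡⟨ lookup∘tabulate _ (k e ↑ʳ t) ⟨
        lookup (GB.restrict e T) (k e ↑ʳ t)        ∎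
        where open ≡-Reasoning

    next-local : ∀ e → LocalState CA CB r ρA (extend σA S) ρB (extend σB T) e
    next-local e with local I e in local≡
    ... | inj₁ empty = inj₁ empty
    ... | inj₂ lp = inj₂ (record
      { ρAₑ = ρAₑ lp ; ρBₑ = ρBₑ lp
      ; wins = Wins-cong r (λ _ → refl) (sym ∘ extend-≗ (GA.restrict e) (λ _ → refl) refl) (λ _ → refl)
                 (sym ∘ extend-≗ (GB.restrict e) (λ _ → refl) (sym (answer≡restrict e lp local≡))) (proj₂ (localAnswer lp))
      ; liftsA = liftsA lp ; liftsB = liftsB lp })

    forthˢ′ : Σ (Subset GB.Nᴳ) λ T → Invariant CA CB r ρA (extend σA S) ρB (extend σB T)
    forthˢ′ = T , record
      { same-vertex      = same-vertex I
      ; same-image       = same-image I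
      ; same-on-vertices = λ { zero v → sym (T-vertex v) ; (suc X) → same-on-vertices I X }
      ; local            = next-local }

  Invariant⇒Wins : ∀ r {CA CB nf ns} {ρA : Fin nf → Fin (Glued.Nᴳ CA)} {σA : Fin ns → Subset (Glued.Nᴳ CA)}
    {ρB : Fin nf → Fin (Glued.Nᴳ CB)} {σB : Fin ns → Subset (Glued.Nᴳ CB)} →
    Invariant CA CB r ρA σA ρB σB → Wins r (Glued.glued CA) (Glued.glued CB) ρA σA ρB σB
  Invariant⇒Wins zero    I = Invariant⇒AgreeOnAtoms I
  Invariant⇒Wins (suc r) I = record
    { atoms  = Invariant⇒AgreeOnAtoms I
    ; forthᵉ = λ a → let (b , I′) = ElementMove.forthᵉ′ I a in b , Invariant⇒Wins r I′
    ; backᵉ  = λ b → let (a , I′) = ElementMove.forthᵉ′ (Invariant-sym I) b in a , Invariant⇒Wins r (Invariant-sym I′)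
    ; forthˢ = λ S → let (T , I′) = SetMove.forthˢ′ I S in T , Invariant⇒Wins r I′
    ; backˢ  = λ T → let (S , I′) = SetMove.forthˢ′ (Invariant-sym I) T in S , Invariant⇒Wins r (Invariant-sym I′) }

module _ {V : Vocab} where

  moduli : ∀ {nf ns} → Formula V nf ns → List ℕ
  moduli (atom R ts) = []
  moduli (eq t u)    = []
  moduli (mem t X)   = []
  moduli (cnt k m X) = m ∷ []
  moduli (neg φ)     = moduli φ
  moduli (and φ ψ)   = moduli φ ++ moduli ψ
  moduli (ex1 φ)     = moduli φ
  moduli (ex2 φ)     = moduli φ

  moduli-nonZero : ∀ {nf ns} (φ : Formula V nf ns) → All NonZero (moduli φ)
  moduli-nonZero (atom R ts)           = []
  moduli-nonZero (eq t u)              = []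
  moduli-nonZero (mem t X)             = []
  moduli-nonZero (cnt k zero ⦃ () ⦄ X)
  moduli-nonZero (cnt k (suc m) X)     = _ ∷ []
  moduli-nonZero (neg φ)               = moduli-nonZero φ
  moduli-nonZero (and φ ψ)             = ++⁺ (moduli-nonZero φ) (moduli-nonZero ψ)
  moduli-nonZero (ex1 φ)               = moduli-nonZero φ
  moduli-nonZero (ex2 φ)               = moduli-nonZero φ

  ModuliIn⇒All : ∀ {nf ns} {M : ℕ → Set} (φ : Formula V nf ns) → ModuliIn M φ → All M (moduli φ)
  ModuliIn⇒All (atom R ts) _        = []
  ModuliIn⇒All (eq t u)    _        = []
  ModuliIn⇒All (mem t X)   _        = []
  ModuliIn⇒All (cnt k m X) Mm       = Mm ∷ []
  ModuliIn⇒All (neg φ)     m        = ModuliIn⇒All φ m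
  ModuliIn⇒All (and φ ψ)   (m , m') = ++⁺ (ModuliIn⇒All φ m) (ModuliIn⇒All ψ m')
  ModuliIn⇒All (ex1 φ)     m        = ModuliIn⇒All φ m
  ModuliIn⇒All (ex2 φ)     m        = ModuliIn⇒All φ m

  moduli⇒ModuliIn : ∀ {nf ns} {M : ℕ → Set} (φ : Formula V nf ns) → (∀ {m} → m ∈ₗ moduli φ → M m) → ModuliIn M φ
  moduli⇒ModuliIn (atom R ts) h = tt
  moduli⇒ModuliIn (eq t u)    h = tt
  moduli⇒ModuliIn (mem t X)   h = tt
  moduli⇒ModuliIn (cnt k m X) h = h (here refl)
  moduli⇒ModuliIn (neg φ)     h = moduli⇒ModuliIn φ h
  moduli⇒ModuliIn (and φ ψ)   h = moduli⇒ModuliIn φ (h ∘ ∈-++⁺ˡ) , moduli⇒ModuliIn ψ (h ∘ ∈-++⁺ʳ (moduli φ))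
  moduli⇒ModuliIn (ex1 φ)     h = moduli⇒ModuliIn φ h
  moduli⇒ModuliIn (ex2 φ)     h = moduli⇒ModuliIn φ h

  Equiv-sym : ∀ {r M} {A B : Model V} → Equiv r M A B → Equiv r M B A
  Equiv-sym A≈B φ q m = ⇔-sym (A≈B φ q m)

record SourcesFirstIso {sz k : ℕ} (c : Fin k → Fin sz) : Set where
  field
    rest    : ℕ
    iso     : Fin sz ↔ Fin (k + rest)
    iso-src : ∀ j → Inverse.to iso (c j) ≡ j ↑ˡ rest

sourcesFirstIso : ∀ {sz} k (c : Fin k → Fin sz) → Injective _≡_ _≡_ c → SourcesFirstIso c
sourcesFirstIso zero c _ = record { rest = _ ; iso = ↔-id _ ; iso-src = λ () }
sourcesFirstIso {zero} (suc k) c _ with c zero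
... | ()
sourcesFirstIso {suc sz} (suc k) c c-injective = record
  { rest = R.rest ; iso = mk↔ₛ′ to′ from′ to∘from from∘to ; iso-src = to∘c }
  where
  c₀≢ : ∀ j → c zero ≢ c (suc j)
  c₀≢ j p with c-injective p
  ... | ()
  c′ : Fin k → Fin sz
  c′ j = punchOut (c₀≢ j)
  module R = SourcesFirstIso (sourcesFirstIso k c′ λ {i} {j} p → suc-injective (c-injective (punchOut-injective (c₀≢ i) (c₀≢ j) p)))
  toR : Fin sz → Fin (k + R.rest)
  toR = Inverse.to R.iso
  fromR : Fin (k + R.rest) → Fin sz
  fromR = Inverse.from R.iso

  -- c zero goes to the front; everything else is renumbered by punching c zero out.
  to-with : ∀ x → Dec (c zero ≡ x) → Fin (suc (k + R.rest))
  to-with x (yes _) = zero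
  to-with x (no c₀≢x) = suc (toR (punchOut c₀≢x))

  to′ : Fin (suc sz) → Fin (suc (k + R.rest))
  to′ x = to-with x (c zero ≟ᶠ x)

  from′ : Fin (suc (k + R.rest)) → Fin (suc sz)
  from′ zero    = c zero
  from′ (suc y) = punchIn (c zero) (fromR y)

  to∘from : ∀ y → to′ (from′ y) ≡ y
  to∘from zero with c zero ≟ᶠ c zero
  ... | yes _ = refl
  ... | no c₀≢c₀ = ⊥-elim (c₀≢c₀ refl)
  to∘from (suc y) with c zero ≟ᶠ punchIn (c zero) (fromR y)
  ... | yes p = ⊥-elim (punchInᵢ≢i (c zero) (fromR y) (sym p))
  ... | no _ = cong suc (trans (cong toR (trans (punchOut-cong (c zero) refl) (punchOut-punchIn (c zero))))
                               (Inverse.strictlyInverseˡ R.iso y))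

  from∘to : ∀ x → from′ (to′ x) ≡ x
  from∘to x with c zero ≟ᶠ x
  ... | yes p = p
  ... | no c₀≢x = trans (cong (punchIn (c zero)) (Inverse.strictlyInverseʳ R.iso (punchOut c₀≢x))) (punchIn-punchOut c₀≢x)

  to∘c : ∀ j → to′ (c j) ≡ j ↑ˡ R.rest
  to∘c zero with c zero ≟ᶠ c zero
  ... | yes _ = refl
  ... | no c₀≢c₀ = ⊥-elim (c₀≢c₀ refl)
  to∘c (suc j) with c zero ≟ᶠ c (suc j)
  ... | yes p = ⊥-elim (c₀≢ j p)
  ... | no _ = cong suc (trans (cong toR (punchOut-cong (c zero) refl)) (R.iso-src j))

injective? : ∀ {a b} (f : Fin a → Fin b) → Dec (Injective _≡_ _≡_ f)
injective? f with all? (λ i → all? λ j → (f i ≟ᶠ f j) →-dec (i ≟ᶠ j))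
... | yes inj = yes λ {i} {j} → inj i j
... | no ¬inj = no λ inj → ¬inj λ i j → inj

Equiv-injective : ∀ {s} {ar : Fin s → ℕ} {k r M} {A B : Model (VocΣ ar k)} → Equiv r M A B →
  Injective _≡_ _≡_ (const A) → Injective _≡_ _≡_ (const B)
Equiv-injective A≈B inj {i} {j} = inj ∘ from (A≈B (eq (con i) (con j)) z≤n tt)

module Substitution {s : ℕ} (ar : Fin s → ℕ) (X : RankedSet) {n : ℕ} (G : Hypergraph X n) (wf : WellFormed G) where
  arityOf : Fin (edges G) → ℕ
  arityOf e = arity X (label G e)

  open Gluing ar arityOf (att G) wf

  default : ∀ {k} → SourcesFirst k
  default = record { rest = 0 ; relˢ = λ _ _ → false }

  -- Components with coinciding sources are never models of hypergraphs; they are replaced by an arbitrary fixed one.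
  component : ∀ {k} → Model (VocΣ ar k) → SourcesFirst k
  component {k} A with injective? (const A)
  ... | yes inj = record { rest = N.rest ; relˢ = λ R us → rel A R (map (Inverse.from N.iso) us) }
    where module N = SourcesFirstIso (sourcesFirstIso k (const A) inj)
  ... | no _ = default

  component-≅ : ∀ {k} (A : Model (VocΣ ar k)) → Injective _≡_ _≡_ (const A) → toModel (component A) ≅ A
  component-≅ {k} A inj with injective? (const A)
  ... | no ¬inj = ⊥-elim (¬inj inj)
  ... | yes inj′ = record
    { bij       = ↔-sym N.iso
    ; relPres   = λ R xs → refl
    ; constPres = λ j → trans (cong (Inverse.from N.iso) (sym (N.iso-src j))) (Inverse.strictlyInverseʳ N.iso (const A j)) }
    where module N = SourcesFirstIso (sourcesFirstIso k (const A) inj′)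

  component-default : ∀ {k} (A : Model (VocΣ ar k)) → ¬ Injective _≡_ _≡_ (const A) → component A ≡ default
  component-default A ¬inj with injective? (const A)
  ... | yes inj = ⊥-elim (¬inj inj)
  ... | no _    = refl

  component-≈ : ∀ {k r M} {A B : Model (VocΣ ar k)} → Equiv r M A B → Equiv r M (toModel (component A)) (toModel (component B))
  component-≈ {k} {r} {M} {A} {B} A≈B = by-cases (injective? (const A))
    where
    by-cases : Dec (Injective _≡_ _≡_ (const A)) → Equiv r M (toModel (component A)) (toModel (component B))
    by-cases (yes iA) = ≅-reflects-Equiv (component-≅ A iA) (component-≅ B (Equiv-injective A≈B iA)) A≈B
    by-cases (no ¬iA) rewrite component-default A ¬iA | component-default B (¬iA ∘ Equiv-injective (Equiv-sym A≈B)) =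
      λ _ _ _ → mk⇔ id id

  Family : Set
  Family = (x : Carrier X) → Model (VocΣ ar (arity X x))

  components : Family → Components
  components As e = component (As (label G e))

  substitute : Family → Model (VocΣ ar n)
  substitute As = Glued.glued (components As)

  substitute-compatible : CompatibleCMSO substitute
  substitute-compatible r M As Bs As≈Bs φ q m =
    Game.Wins-sound (moduli φ) r (Invariant⇒Wins r start) φ q (moduli⇒ModuliIn φ id)
    where
    open Composition ar arityOf (att G) wf (moduli φ)
    start : ∀ {ρA σA ρB σB} → Invariant (components As) (components Bs) r {0} {0} ρA σA ρB σB
    start = record
      { same-vertex = λ () ; same-image = λ () ; same-on-vertices = λ ()
      ; local = λ e → inj₂ record
          { ρAₑ = λ () ; ρBₑ = λ () ; liftsA = λ () ; liftsB = λ ()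
          ; wins = Hintikka.Equiv⇒Wins ar (arityOf e) (moduli φ) (moduli-nonZero φ) r
                     (component-≈ (As≈Bs (label G e))) (ModuliIn⇒All φ m) } }

-- The model of a flattening

inj₂≢inj₁ : ∀ {A B : Set} {a : A} {b : B} → inj₂ a ≢ inj₁ b
inj₂≢inj₁ ()

fromInj₂ : ∀ {K B : Set} (y : K ⊎ B) → (∀ j → y ≢ inj₁ j) → B
fromInj₂ (inj₁ j) y≢ = ⊥-elim (y≢ j refl)
fromInj₂ (inj₂ b) _  = b

inj₂-fromInj₂ : ∀ {K B : Set} (y : K ⊎ B) y≢ → inj₂ (fromInj₂ y y≢) ≡ y
inj₂-fromInj₂ (inj₁ j) y≢ = ⊥-elim (y≢ j refl)
inj₂-fromInj₂ (inj₂ b) _  = refl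

⊎-complement : ∀ {K A B : Set} (f : (K ⊎ A) ↔ (K ⊎ B)) → (∀ j → Inverse.to f (inj₁ j) ≡ inj₁ j) →
  Σ (A ↔ B) λ g → ∀ a → Inverse.to f (inj₂ a) ≡ inj₂ (Inverse.to g a)
⊎-complement {K} {A} {B} f f-fixes = mk↔ₛ′ to′ from′ to∘from from∘to , λ a → sym (inj₂-fromInj₂ _ _)
  where
  module f = Inverse f
  from-fixes : ∀ j → f.from (inj₁ j) ≡ inj₁ j
  from-fixes j = trans (cong f.from (sym (f-fixes j))) (f.strictlyInverseʳ (inj₁ j))
  to′ : A → B
  to′ a = fromInj₂ (f.to (inj₂ a)) λ j p →
    inj₂≢inj₁ (trans (sym (f.strictlyInverseʳ (inj₂ a))) (trans (cong f.from p) (from-fixes j)))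
  from′ : B → A
  from′ b = fromInj₂ (f.from (inj₂ b)) λ j p →
    inj₂≢inj₁ (trans (sym (f.strictlyInverseˡ (inj₂ b))) (trans (cong f.to p) (f-fixes j)))
  to∘from : ∀ b → to′ (from′ b) ≡ b
  to∘from b = inj₂-injective (trans (inj₂-fromInj₂ _ _) (trans (cong f.to (inj₂-fromInj₂ _ _)) (f.strictlyInverseˡ (inj₂ b))))
  from∘to : ∀ a → from′ (to′ a) ≡ a
  from∘to a = inj₂-injective (trans (inj₂-fromInj₂ _ _) (trans (cong f.from (inj₂-fromInj₂ _ _)) (f.strictlyInverseʳ (inj₂ a))))

module ModelOf {s : ℕ} {ar : Fin s → ℕ} {k : ℕ} (K : Hypergraph (FinRanked s ar) k) where

  vertexᴷ : Vtx k (inner K) → Fin ((k + inner K) + edges K)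
  vertexᴷ (inj₁ i) = (i ↑ˡ inner K) ↑ˡ edges K
  vertexᴷ (inj₂ w) = (k ↑ʳ w) ↑ˡ edges K

  edgeᴷ : Fin (edges K) → Fin ((k + inner K) + edges K)
  edgeᴷ f = (k + inner K) ↑ʳ f

  Labelled : Fin s → Fin ((k + inner K) + edges K) → Set
  Labelled a y = Σ (Fin (edges K)) λ f → y ≡ edgeᴷ f × label K f ≡ a

  Incident : Fin (maxAr ar) → (y z : Fin ((k + inner K) + edges K)) → Set
  Incident j y z = Σ (Fin (edges K)) λ f → y ≡ edgeᴷ f × Σ (toℕ j < ar (label K f)) λ j<ar →
                   z ≡ vertexᴷ (att K f (fromℕ< j<ar))

  label-rel : ∀ a y → (rel ⌈ K ⌉ (inj₁ a) (y ∷ []) ≡ true) ⇔ Labelled a y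
  label-rel a y = mk⇔ to′ from′
    where
    to′ : rel ⌈ K ⌉ (inj₁ a) (y ∷ []) ≡ true → Labelled a y
    to′ p with ↑-cases (k + inner K) y
    ... | inj₁ (v , refl) rewrite splitAt-↑ˡ (k + inner K) v (edges K) with p
    ...   | ()
    to′ p | inj₂ (f , refl) rewrite splitAt-↑ʳ (k + inner K) (edges K) f = f , refl , to (⌊⌋≡true⇔ (label K f ≟ᶠ a)) p
    from′ : Labelled a y → rel ⌈ K ⌉ (inj₁ a) (y ∷ []) ≡ true
    from′ (f , refl , lab≡a) rewrite splitAt-↑ʳ (k + inner K) (edges K) f = from (⌊⌋≡true⇔ (label K f ≟ᶠ a)) lab≡a

  incidence-rel : ∀ j y z → (rel ⌈ K ⌉ (inj₂ j) (y ∷ z ∷ []) ≡ true) ⇔ Incident j y z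
  incidence-rel j y z = mk⇔ to′ from′
    where
    to′ : rel ⌈ K ⌉ (inj₂ j) (y ∷ z ∷ []) ≡ true → Incident j y z
    to′ p with ↑-cases (k + inner K) y
    ... | inj₁ (v , refl) rewrite splitAt-↑ˡ (k + inner K) v (edges K) with p
    ...   | ()
    to′ p | inj₂ (f , refl) rewrite splitAt-↑ʳ (k + inner K) (edges K) f with toℕ j <? ar (label K f)
    ...   | no _ with p
    ...     | ()
    to′ p | inj₂ (f , refl) | yes j<ar with att K f (fromℕ< j<ar) in att≡ | to (⌊⌋≡true⇔ _) p
    ...     | inj₁ i | z≡ = f , refl , j<ar , trans (sym z≡) (cong vertexᴷ (sym att≡))
    ...     | inj₂ w | z≡ = f , refl , j<ar , trans (sym z≡) (cong vertexᴷ (sym att≡))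
    from′ : Incident j y z → rel ⌈ K ⌉ (inj₂ j) (y ∷ z ∷ []) ≡ true
    from′ (f , refl , j<ar , refl) rewrite splitAt-↑ʳ (k + inner K) (edges K) f with toℕ j <? ar (label K f)
    ... | no j≮ar = ⊥-elim (j≮ar j<ar)
    ... | yes j<ar′ rewrite <-irrelevant j<ar j<ar′ with att K f (fromℕ< j<ar′)
    ...   | inj₁ i = from (⌊⌋≡true⇔ _) refl
    ...   | inj₂ w = from (⌊⌋≡true⇔ _) refl

module Flattening {s : ℕ} (ar : Fin s → ℕ) (X : RankedSet) {n : ℕ} (G : Hypergraph X n)
    (η : (x : Carrier X) → Hypergraph (FinRanked s ar) (arity X x)) where

  E P : ℕ
  E = edges G
  P = inner G

  arityOf : Fin E → ℕ
  arityOf e = arity X (label G e)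

  H : (e : Fin E) → Hypergraph (FinRanked s ar) (arityOf e)
  H e = η (label G e)

  innerOf edgesOf : Fin E → ℕ
  innerOf e = inner (H e)
  edgesOf e = edges (H e)

  F : Hypergraph (FinRanked s ar) n
  F = ⟦ G ⟧ η

  module MF = ModelOf F
  module MH (e : Fin E) = ModelOf (H e)

  liftG : Vtx n P → Vtx n (P + ΣN E innerOf)
  liftG (inj₁ i) = inj₁ i
  liftG (inj₂ v) = inj₂ (v ↑ˡ ΣN E innerOf)

  placeOf : (e : Fin E) → Vtx (arityOf e) (innerOf e) → Vtx n (P + ΣN E innerOf)
  placeOf e (inj₁ j) = liftG (att G e j)
  placeOf e (inj₂ w) = inj₂ (P ↑ʳ joinΣ innerOf e w)

  att-flatten : ∀ c i → let (e , f) = splitΣ edgesOf c in att F c i ≡ placeOf e (att (H e) f i)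
  att-flatten c i with att (H (proj₁ (splitΣ edgesOf c))) (proj₂ (splitΣ edgesOf c)) i
  ... | inj₂ w = refl
  ... | inj₁ j with att G (proj₁ (splitΣ edgesOf c)) j
  ...   | inj₁ _ = refl
  ...   | inj₂ _ = refl

  embedᶠ : (e : Fin E) → Fin ((arityOf e + innerOf e) + edgesOf e) → Fin ((n + (P + ΣN E innerOf)) + ΣN E edgesOf)
  embedᶠ e = [ MF.vertexᴷ ∘ placeOf e ∘ splitAt (arityOf e) , MF.edgeᴷ ∘ joinΣ edgesOf e ] ∘ splitAt (arityOf e + innerOf e)

  embedᶠ-vertex : ∀ e v → embedᶠ e (MH.vertexᴷ e v) ≡ MF.vertexᴷ (placeOf e v)
  embedᶠ-vertex e (inj₁ j) rewrite splitAt-↑ˡ (arityOf e + innerOf e) (j ↑ˡ innerOf e) (edgesOf e)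
                                 | splitAt-↑ˡ (arityOf e) j (innerOf e) = refl
  embedᶠ-vertex e (inj₂ w) rewrite splitAt-↑ˡ (arityOf e + innerOf e) (arityOf e ↑ʳ w) (edgesOf e)
                                 | splitAt-↑ʳ (arityOf e) (innerOf e) w = refl

  embedᶠ-edge : ∀ e f → embedᶠ e (MH.edgeᴷ e f) ≡ MF.edgeᴷ (joinΣ edgesOf e f)
  embedᶠ-edge e f rewrite splitAt-↑ʳ (arityOf e + innerOf e) (edgesOf e) f = refl

  at-joinΣ : ∀ {K : Fin E → ℕ} (Q : (e : Fin E) → Fin (K e) → Set) e f → Q e f →
    let (e′ , f′) = splitΣ K (joinΣ K e f) in Q e′ f′
  at-joinΣ {K} Q e f q rewrite splitΣ-joinΣ K e f = q

  edgeᶠ-split : ∀ c → let (e , f) = splitΣ edgesOf c in embedᶠ e (MH.edgeᴷ e f) ≡ MF.edgeᴷ c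
  edgeᶠ-split c = trans (embedᶠ-edge _ _) (cong MF.edgeᴷ (joinΣ-splitΣ edgesOf c))

  PieceRelated : ∀ R → Vec (Fin ((n + (P + ΣN E innerOf)) + ΣN E edgesOf)) (relAr (VocΣ ar n) R) → Set
  PieceRelated R ys = Σ (Fin E) λ e → Σ (Vec (Fin ((arityOf e + innerOf e) + edgesOf e)) (relAr (VocΣ ar n) R)) λ us →
                      map (embedᶠ e) us ≡ ys × rel ⌈ H e ⌉ R us ≡ true

  rel-flatten : ∀ R ys → (rel ⌈ F ⌉ R ys ≡ true) ⇔ PieceRelated R ys
  rel-flatten (inj₁ a) (y ∷ []) = mk⇔ to′ from′
    where
    to′ : rel ⌈ F ⌉ (inj₁ a) (y ∷ []) ≡ true → PieceRelated (inj₁ a) (y ∷ [])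
    to′ p = let (c , y≡c , lab≡a) = to (MF.label-rel a y) p
                (e , f) = splitΣ edgesOf c in
      e , MH.edgeᴷ e f ∷ [] , cong (_∷ []) (trans (edgeᶠ-split c) (sym y≡c)) ,
      from (MH.label-rel e a _) (f , refl , lab≡a)
    from′ : PieceRelated (inj₁ a) (y ∷ []) → rel ⌈ F ⌉ (inj₁ a) (y ∷ []) ≡ true
    from′ (e , u ∷ [] , u↦y , Ru) =
      let (f , u≡f , lab≡a) = to (MH.label-rel e a u) Ru in
      from (MF.label-rel a y) (joinΣ edgesOf e f ,
        trans (sym (∷-injectiveˡ u↦y)) (trans (cong (embedᶠ e) u≡f) (embedᶠ-edge e f)) ,
        at-joinΣ (λ e f → label (H e) f ≡ a) e f lab≡a)
  rel-flatten (inj₂ j) (y ∷ z ∷ []) = mk⇔ to′ from′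
    where
    to′ : rel ⌈ F ⌉ (inj₂ j) (y ∷ z ∷ []) ≡ true → PieceRelated (inj₂ j) (y ∷ z ∷ [])
    to′ p = let (c , y≡c , j<ar , z≡) = to (MF.incidence-rel j y z) p
                (e , f) = splitΣ edgesOf c in
      e , MH.edgeᴷ e f ∷ MH.vertexᴷ e (att (H e) f (fromℕ< j<ar)) ∷ [] ,
      cong₂ _∷_ (trans (edgeᶠ-split c) (sym y≡c))
        (cong (_∷ []) (trans (embedᶠ-vertex e (att (H e) f (fromℕ< j<ar)))
                             (trans (cong MF.vertexᴷ (sym (att-flatten c (fromℕ< j<ar)))) (sym z≡)))) ,
      from (MH.incidence-rel e j _ _) (f , refl , j<ar , refl)
    from′ : PieceRelated (inj₂ j) (y ∷ z ∷ []) → rel ⌈ F ⌉ (inj₂ j) (y ∷ z ∷ []) ≡ true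
    from′ (e , u ∷ u′ ∷ [] , us↦yz , Ruu′) =
      let (f , u≡f , j<ar , u′≡) = to (MH.incidence-rel e j u u′) Ruu′
          (u↦y , u′↦z) = ∷-injective us↦yz
          y≡ = trans (sym u↦y) (trans (cong (embedᶠ e) u≡f) (embedᶠ-edge e f))
          z≡ = trans (sym (∷-injectiveˡ u′↦z)) (trans (cong (embedᶠ e) u′≡) (embedᶠ-vertex e (att (H e) f (fromℕ< j<ar))))
          (j<ar′ , z≡′) = at-joinΣ (λ e f → Σ (toℕ j < ar (label (H e) f)) λ j<ar →
                                      z ≡ MF.vertexᴷ (placeOf e (att (H e) f (fromℕ< j<ar)))) e f (j<ar , z≡)
      in from (MF.incidence-rel j y z) (joinΣ edgesOf e f , y≡ , j<ar′ ,
           trans z≡′ (cong MF.vertexᴷ (sym (att-flatten (joinΣ edgesOf e f) (fromℕ< j<ar′)))))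

  ΣN↔Σ : ∀ {N} (K : Fin N → ℕ) → Fin (ΣN N K) ↔ Σ (Fin N) (Fin ∘ K)
  ΣN↔Σ K = mk↔ₛ′ (splitΣ K) (λ (e , w) → joinΣ K e w) (λ (e , w) → splitΣ-joinΣ K e w) (joinΣ-splitΣ K)

  flatParts : Fin ((n + (P + ΣN E innerOf)) + ΣN E edgesOf) ↔
              (Fin (n + P) ⊎ Σ (Fin E) λ e → Fin (innerOf e) ⊎ Fin (edgesOf e))
  flatParts = begin
    Fin ((n + (P + ΣI)) + ΣD)                                         ↔⟨ +↔⊎ ⟩
    (Fin (n + (P + ΣI)) ⊎ Fin ΣD)                                     ↔⟨ ⊎-cong +↔⊎ (↔-id _) ⟩
    ((Fin n ⊎ Fin (P + ΣI)) ⊎ Fin ΣD)                                 ↔⟨ ⊎-cong (⊎-cong (↔-id _) +↔⊎) (↔-id _) ⟩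
    ((Fin n ⊎ (Fin P ⊎ Fin ΣI)) ⊎ Fin ΣD)                             ↔⟨ ⊎-assoc 0ℓ _ _ _ ⟩
    (Fin n ⊎ ((Fin P ⊎ Fin ΣI) ⊎ Fin ΣD))                             ↔⟨ ⊎-cong (↔-id _) (⊎-assoc 0ℓ _ _ _) ⟩
    (Fin n ⊎ (Fin P ⊎ (Fin ΣI ⊎ Fin ΣD)))                             ↔⟨ ⊎-assoc 0ℓ _ _ _ ⟨
    ((Fin n ⊎ Fin P) ⊎ (Fin ΣI ⊎ Fin ΣD))                             ↔⟨ ⊎-cong (↔-sym +↔⊎) (⊎-cong (ΣN↔Σ innerOf) (ΣN↔Σ edgesOf)) ⟩
    (Fin (n + P) ⊎ (Σ (Fin E) (Fin ∘ innerOf) ⊎ Σ (Fin E) (Fin ∘ edgesOf))) ↔⟨ ⊎-cong (↔-id _) Σ-distribˡ-⊎ ⟨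
    (Fin (n + P) ⊎ Σ (Fin E) λ e → Fin (innerOf e) ⊎ Fin (edgesOf e)) ∎
    where
    open EquationalReasoning {k = bijection}
    ΣI ΣD : ℕ
    ΣI = ΣN E innerOf
    ΣD = ΣN E edgesOf

  flatParts-vertex : ∀ x → Inverse.to flatParts (MF.vertexᴷ (liftG x)) ≡ inj₁ ([ _↑ˡ P , n ↑ʳ_ ] x)
  flatParts-vertex (inj₁ i) rewrite splitAt-↑ˡ (n + (P + ΣN E innerOf)) (i ↑ˡ (P + ΣN E innerOf)) (ΣN E edgesOf)
                                  | splitAt-↑ˡ n i (P + ΣN E innerOf) = refl
  flatParts-vertex (inj₂ p) rewrite splitAt-↑ˡ (n + (P + ΣN E innerOf)) (n ↑ʳ (p ↑ˡ ΣN E innerOf)) (ΣN E edgesOf)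
                                  | splitAt-↑ʳ n (P + ΣN E innerOf) (p ↑ˡ ΣN E innerOf)
                                  | splitAt-↑ˡ P p (ΣN E innerOf) = refl

  flatParts-new-vertex : ∀ e w → Inverse.to flatParts (MF.vertexᴷ (inj₂ (P ↑ʳ joinΣ innerOf e w))) ≡ inj₂ (e , inj₁ w)
  flatParts-new-vertex e w rewrite splitAt-↑ˡ (n + (P + ΣN E innerOf)) (n ↑ʳ (P ↑ʳ joinΣ innerOf e w)) (ΣN E edgesOf)
                                 | splitAt-↑ʳ n (P + ΣN E innerOf) (P ↑ʳ joinΣ innerOf e w)
                                 | splitAt-↑ʳ P (ΣN E innerOf) (joinΣ innerOf e w)
                                 | splitΣ-joinΣ innerOf e w = refl

  flatParts-edge : ∀ e f → Inverse.to flatParts (MF.edgeᴷ (joinΣ edgesOf e f)) ≡ inj₂ (e , inj₂ f)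
  flatParts-edge e f rewrite splitAt-↑ʳ (n + (P + ΣN E innerOf)) (ΣN E edgesOf) (joinΣ edgesOf e f)
                           | splitΣ-joinΣ edgesOf e f = refl

  module _ (wf : WellFormed G) (C : Gluing.Components ar arityOf (att G) wf)
      (Ψ : ∀ e → Gluing.toModel ar arityOf (att G) wf (C e) ≅ ⌈ H e ⌉) where
    open Gluing ar arityOf (att G) wf
    open Glued C
    module Ψ e = _≅_ (Ψ e)

    pieceParts : ∀ e → Fin ((arityOf e + innerOf e) + edgesOf e) ↔ (Fin (arityOf e) ⊎ (Fin (innerOf e) ⊎ Fin (edgesOf e)))
    pieceParts e = ⊎-assoc 0ℓ _ _ _ ↔-∘ (⊎-cong +↔⊎ (↔-id _) ↔-∘ +↔⊎)

    pieceParts-source : ∀ e j → Inverse.to (pieceParts e) ((j ↑ˡ innerOf e) ↑ˡ edgesOf e) ≡ inj₁ j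
    pieceParts-source e j rewrite splitAt-↑ˡ (arityOf e + innerOf e) (j ↑ˡ innerOf e) (edgesOf e)
                                | splitAt-↑ˡ (arityOf e) j (innerOf e) = refl

    swapped : ∀ e → (Fin (arityOf e) ⊎ Fin (restOf e)) ↔ (Fin (arityOf e) ⊎ (Fin (innerOf e) ⊎ Fin (edgesOf e)))
    swapped e = pieceParts e ↔-∘ (Ψ.bij e ↔-∘ ↔-sym +↔⊎)

    swapped-fixes : ∀ e j → Inverse.to (swapped e) (inj₁ j) ≡ inj₁ j
    swapped-fixes e j = trans (cong (Inverse.to (pieceParts e)) (Ψ.constPres e j)) (pieceParts-source e j)

    -- The isomorphism fixes the sources, so it matches the remaining elements with the new vertices and hyperedges.
    interiorParts : ∀ e → Fin (restOf e) ↔ (Fin (innerOf e) ⊎ Fin (edgesOf e))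
    interiorParts e = proj₁ (⊎-complement (swapped e) (swapped-fixes e))

    interiorParts-spec : ∀ e t → Inverse.to (swapped e) (inj₂ t) ≡ inj₂ (Inverse.to (interiorParts e) t)
    interiorParts-spec e = proj₂ (⊎-complement (swapped e) (swapped-fixes e))

    piece : ∀ e → Fin (innerOf e) ⊎ Fin (edgesOf e) → Fin ((n + (P + ΣN E innerOf)) + ΣN E edgesOf)
    piece e (inj₁ w) = MF.vertexᴷ (inj₂ (P ↑ʳ joinΣ innerOf e w))
    piece e (inj₂ d) = MF.edgeᴷ (joinΣ edgesOf e d)

    Ψ-interior : ∀ e t → embedᶠ e (Inverse.to (Ψ.bij e) (arityOf e ↑ʳ t)) ≡ piece e (Inverse.to (interiorParts e) t)
    Ψ-interior e t = by-part (Inverse.to (interiorParts e) t)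
      (Inverse.inverseʳ (pieceParts e) (sym (interiorParts-spec e t)))
      where
      by-part : ∀ z → Inverse.from (pieceParts e) (inj₂ z) ≡ Inverse.to (Ψ.bij e) (arityOf e ↑ʳ t) →
        embedᶠ e (Inverse.to (Ψ.bij e) (arityOf e ↑ʳ t)) ≡ piece e z
      by-part (inj₁ w) Ψt≡ = trans (cong (embedᶠ e) (sym Ψt≡)) (embedᶠ-vertex e (inj₂ w))
      by-part (inj₂ d) Ψt≡ = trans (cong (embedᶠ e) (sym Ψt≡)) (embedᶠ-edge e d)

    Φ : Fin Nᴳ ↔ Fin ((n + (P + ΣN E innerOf)) + ΣN E edgesOf)
    Φ = begin
      Fin ((n + P) + ΣN E restOf)                                              ↔⟨ +↔⊎ ⟩
      (Fin (n + P) ⊎ Fin (ΣN E restOf))                                        ↔⟨ ⊎-cong (↔-id _) (ΣN↔Σ restOf) ⟩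
      (Fin (n + P) ⊎ Σ (Fin E) (Fin ∘ restOf))                                 ↔⟨ ⊎-cong (↔-id _) (Σ-↔ (↔-id _) (interiorParts _)) ⟩
      (Fin (n + P) ⊎ Σ (Fin E) λ e → Fin (innerOf e) ⊎ Fin (edgesOf e))        ↔⟨ flatParts ⟨
      Fin ((n + (P + ΣN E innerOf)) + ΣN E edgesOf)                            ∎
      where open EquationalReasoning {k = bijection}

    Φ-vertex : ∀ x → Inverse.to Φ (vertex (vtx x)) ≡ MF.vertexᴷ (liftG x)
    Φ-vertex x rewrite splitAt-↑ˡ (n + P) (vtx x) (ΣN E restOf) = Inverse.inverseʳ flatParts (sym (flatParts-vertex x))

    Φ-interior : ∀ e t → Inverse.to Φ (interior e t) ≡ piece e (Inverse.to (interiorParts e) t)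
    Φ-interior e t rewrite splitAt-↑ʳ (n + P) (ΣN E restOf) (joinΣ restOf e t) | splitΣ-joinΣ restOf e t =
      Inverse.inverseʳ flatParts (sym (flatParts-piece (Inverse.to (interiorParts e) t)))
      where
      flatParts-piece : ∀ z → Inverse.to flatParts (piece e z) ≡ inj₂ (e , z)
      flatParts-piece (inj₁ w) = flatParts-new-vertex e w
      flatParts-piece (inj₂ d) = flatParts-edge e d

    Φ-embed : ∀ e u → Inverse.to Φ (embed e u) ≡ embedᶠ e (Inverse.to (Ψ.bij e) u)
    Φ-embed e u with ↑-cases (arityOf e) u
    ... | inj₁ (j , refl) = begin
      Inverse.to Φ (embed e (j ↑ˡ restOf e))          ≡⟨ cong (Inverse.to Φ) (embed-source e j) ⟩
      Inverse.to Φ (vertex (vtx (att G e j)))         ≡⟨ Φ-vertex (att G e j) ⟩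
      MF.vertexᴷ (placeOf e (inj₁ j))                 ≡⟨ embedᶠ-vertex e (inj₁ j) ⟨
      embedᶠ e (MH.vertexᴷ e (inj₁ j))                ≡⟨ cong (embedᶠ e) (Ψ.constPres e j) ⟨
      embedᶠ e (Inverse.to (Ψ.bij e) (j ↑ˡ restOf e)) ∎
      where open ≡-Reasoning
    ... | inj₂ (t , refl) = trans (cong (Inverse.to Φ) (embed-interior e t)) (trans (Φ-interior e t) (sym (Ψ-interior e t)))

    map-Φ-embed : ∀ {l} e (us : Vec (Fin (arityOf e + restOf e)) l) →
      map (Inverse.to Φ) (map (embed e) us) ≡ map (embedᶠ e) (map (Inverse.to (Ψ.bij e)) us)
    map-Φ-embed e us = trans (sym (map-∘ _ _ us)) (trans (map-cong (Φ-embed e) us) (map-∘ _ _ us))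

    glued≅⌈⟦G⟧η⌉ : glued ≅ ⌈ ⟦ G ⟧ η ⌉
    glued≅⌈⟦G⟧η⌉ = record { bij = Φ ; relPres = relPres ; constPres = λ c → Φ-vertex (inj₁ c) }
      where
      relPres : ∀ R xs → rel ⌈ F ⌉ R (map (Inverse.to Φ) xs) ≡ rel glued R xs
      relPres R xs = ⇔→≡ (⇔-trans (rel-flatten R _) (⇔-trans (mk⇔ to′ from′) (⇔-sym (rel-glued R xs))))
        where
        to′ : PieceRelated R (map (Inverse.to Φ) xs) → Related R xs
        to′ (e , vs , vs↦xs , Rvs) = e , map (Inverse.from (Ψ.bij e)) vs ,
          map-injective (Injection.injective (↔⇒↣ Φ)) (trans (map-Φ-embed e _) (trans (cong (map (embedᶠ e)) to∘from) vs↦xs)) ,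
          trans (sym (Ψ.relPres e R _)) (trans (cong (rel ⌈ H e ⌉ R) to∘from) Rvs)
          where
          to∘from : map (Inverse.to (Ψ.bij e)) (map (Inverse.from (Ψ.bij e)) vs) ≡ vs
          to∘from = trans (sym (map-∘ _ _ vs)) (trans (map-cong (Inverse.strictlyInverseˡ (Ψ.bij e)) vs) (map-id vs))
        from′ : Related R xs → PieceRelated R (map (Inverse.to Φ) xs)
        from′ (e , us , us↦xs , Rus) = e , map (Inverse.to (Ψ.bij e)) us ,
          trans (sym (map-Φ-embed e us)) (cong (map (Inverse.to Φ)) us↦xs) , trans (Ψ.relPres e R us) Rus

⌈⌉-sources-injective : ∀ {s} {ar : Fin s → ℕ} {k} (K : Hypergraph (FinRanked s ar) k) → Injective _≡_ _≡_ (const ⌈ K ⌉)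
⌈⌉-sources-injective K = ↑ˡ-injective _ _ _ ∘′ ↑ˡ-injective _ _ _

-- The pieces η x need not be well formed: only the incidence lists of G are used injectively.
lemma4p13 : (s : ℕ) (ar : Fin s → ℕ) (X : RankedSet) (n : ℕ)
    (G : Hypergraph X n) → WellFormed G →
    Σ (((x : Carrier X) → Model (VocΣ ar (arity X x))) → Model (VocΣ ar n)) λ f →
      CompatibleCMSO f ×
      ((η : (x : Carrier X) → Hypergraph (FinRanked s ar) (arity X x)) →
        (∀ x → WellFormed (η x)) →
        f (λ x → ⌈ η x ⌉) ≅ ⌈ ⟦ G ⟧ η ⌉)
lemma4p13 s ar X n G wf = substitute , substitute-compatible , λ η _ →
  Flattening.glued≅⌈⟦G⟧η⌉ ar X G η wf _ λ e → component-≅ ⌈ η (label G e) ⌉ (⌈⌉-sources-injective (η (label G e)))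
  where open Substitution ar X G wf
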